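{- Let $d$ be a positive integer that is not a perfect square, let $(x_1,y_1)$ be the minimal solution in positive integers of $x^2-dy^2=1$, let $p_k/q_k$ ($k\ge0$) be the convergents of the continued fraction expansion $\sqrt{d}=[a_0,\overline{a_1,\dots,a_{L-1},2a_0}]$, and let $L$ be the length of its period. Then for every integer $n\ge1$, $$Q_{2n}\left(d,\frac{x_1+1}{y_1}\right)=\frac{p_{nL-1}}{q_{nL-1}}\ \text{ if } L \text{ is even},\qquad Q_{2n}\left(d,\frac{x_1+1}{y_1}\right)=\frac{p_{2nL-1}}{q_{2nL-1}}\ \text{ if } L \text{ is odd}.$$
   Context: $N_m(d,z)=\sum_{k=0}^{\lfloor m/2\rfloor}\binom{m}{2k}d^kz^{m-2k}$, $D_m(d,z)=\sum_{k=0}^{\lfloor m/2\rfloor}\binom{m}{2k+1}d^kz^{m-2k-1}$, and the Rédei rational function is $Q_m(d,z)=N_m(d,z)/D_m(d,z)$. The convergents are $p_k/q_k=[a_0,\dots,a_k]$ in lowest terms. -}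

module Defs where

open import Data.Nat as ℕ using (ℕ; zero; suc; _∸_; _≤?_; ⌊_/2⌋)
open import Data.Nat.DivMod using (_/_)
open import Data.Nat.Combinatorics using (_C_)
open import Data.Product using (_×_; _,_; proj₁; proj₂)
open import Data.Integer using (+_)
open import Data.Rational as ℚ using (ℚ; 0ℚ; 1ℚ)
open import Relation.Nullary using (yes; no)

-- truncated natural division, with n div 0 = 0 (only used with c > 0)
_div_ : ℕ → ℕ → ℕ
n div zero    = 0
n div (suc c) = n / suc c

ι : ℕ → ℚ
ι n = (+ n) ℚ./ 1

_^q_ : ℚ → ℕ → ℚ
x ^q zero  = 1ℚ
x ^q suc n = x ℚ.* (x ^q n)

sumTo : ℕ → (ℕ → ℚ) → ℚ
sumTo zero    f = f 0
sumTo (suc n) f = sumTo n f ℚ.+ f (suc n)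

Nr : ℕ → ℚ → ℚ → ℚ
Nr m d z = sumTo ⌊ m /2⌋ (λ k → ι (m C (2 ℕ.* k)) ℚ.* (d ^q k) ℚ.* (z ^q (m ∸ 2 ℕ.* k)))

Dr : ℕ → ℚ → ℚ → ℚ
Dr m d z = sumTo ⌊ m /2⌋ (λ k → ι (m C (suc (2 ℕ.* k))) ℚ.* (d ^q k) ℚ.* (z ^q (m ∸ suc (2 ℕ.* k))))

-- Q_m(d,z) = N_m(d,z)/D_m(d,z) holds iff D ≠ 0 and we compare by
-- cross-multiplication.

isqrtAux : ℕ → ℕ → ℕ
isqrtAux d zero    = 0
isqrtAux d (suc a) with suc a ℕ.* suc a ≤? d
... | yes _ = suc a
... | no  _ = isqrtAux d a

isqrt : ℕ → ℕ
isqrt d = isqrtAux d d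

-- The k-th complete quotient of √d is  ξ_k = (m_k + √d) / c_k,
-- with ξ_0 = √d  (m_0 = 0, c_0 = 1) and ξ_{k+1} = 1/(ξ_k - a_k), where
-- a_k = ⌊ξ_k⌋ = ⌊(m_k + ⌊√d⌋)/c_k⌋.  This gives
-- m_{k+1} = a_k c_k - m_k,  c_{k+1} = (d - m_{k+1}^2)/c_k.
pquot : ℕ → ℕ → ℕ → ℕ
pquot d m c = (m ℕ.+ isqrt d) div c

cstep : ℕ → ℕ × ℕ → ℕ × ℕ
cstep d (m , c) = m' , ((d ∸ m' ℕ.* m') div c)
  where m' = pquot d m c ℕ.* c ∸ m

cstate : ℕ → ℕ → ℕ × ℕ
cstate d zero    = 0 , 1
cstate d (suc k) = cstep d (cstate d k)

cf : ℕ → ℕ → ℕ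
cf d k = pquot d (proj₁ (cstate d k)) (proj₂ (cstate d k))

-- convergent numerators / denominators p_k, q_k
-- (p_{-1}=1, p_{-2}=0, q_{-1}=0, q_{-2}=1, x_k = a_k x_{k-1} + x_{k-2})
convP : ℕ → ℕ → ℕ
convP d zero          = cf d 0
convP d (suc zero)    = cf d 1 ℕ.* cf d 0 ℕ.+ 1
convP d (suc (suc k)) = cf d (suc (suc k)) ℕ.* convP d (suc k) ℕ.+ convP d k

convQ : ℕ → ℕ → ℕ
convQ d zero          = 1
convQ d (suc zero)    = cf d 1
convQ d (suc (suc k)) = cf d (suc (suc k)) ℕ.* convQ d (suc k) ℕ.+ convQ d k

-- the rational a/b (b > 0 in all uses; frac a 0 = 0 is a junk value)
frac : ℕ → ℕ → ℚ
frac a zero    = 0ℚ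
frac a (suc b) = (+ a) ℚ./ suc b

{-# OPTIONS --safe #-}
-- The Rédei polynomials satisfy N_m + D_m √d = (z + √d)^m. For z = (x₁ + 1)/y₁ one has
-- (z + √d)² = c (x₁ + y₁√d) with c = 2(x₁ + 1)/y₁², so Q_{2n}(d, z) = X_n/Y_n where
-- X_n + Y_n √d = (x₁ + y₁√d)^n.
--
-- On the continued fraction side, write the complete quotients of √d as (m_k + √d)/c_k.
-- Lagrange's descent through the forms c_k u² − 2 m_k u v − c_{k−1} v² shows that
-- x₁ + y₁√d = p_{j−1} + q_{j−1}√d for some even j with c_j = 1. Any index with c = 1 is a
-- period, so L ∣ j and c_L = 1; the least even such index is P = L or 2L according to the
-- parity of L, and minimality of y₁ forces j = P. Finally, shifting indices by P multiplies
-- p + q√d by x₁ + y₁√d, so p_{nP−1} + q_{nP−1}√d = (x₁ + y₁√d)^n.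

module Submission where

open import Defs
open import Data.Nat as ℕ using (ℕ; zero; suc; _+_; _*_; _∸_; _^_; _≤_; _<_; _≤?_; z≤n; s≤s; ⌊_/2⌋)
import Data.Nat.Properties as ℕP
open import Data.Nat.Combinatorics using (_C_; k>n⇒nCk≡0; nCk+nC[k+1]≡[n+1]C[k+1])
open import Data.Nat.Coprimality using (1-coprimeTo)
import Data.Nat.Coprimality as Coprime
open import Data.Nat.DivMod using (_/_; _%_; m≡m%n+[m/n]*n; m%n<n; m*n/n≡m; m/n*n≤m; m≥n⇒m/n>0; n/1≡n)
open import Data.Nat.Divisibility using (_∣_; divides; m∣m*n)
open import Data.Nat.Primality using (euclidsLemma; prime[2])
open import Data.Nat.Tactic.RingSolver using () renaming (solve-∀ to ℕ-solve)
open import Data.Integer as ℤ using (ℤ; +_; -[1+_])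
import Data.Integer.Properties as ℤP
open import Data.Integer.Tactic.RingSolver using () renaming (solve-∀ to ℤ-solve)
open import Data.Rational as ℚ using (ℚ; 0ℚ; 1ℚ; mkℚ)
import Data.Rational.Properties as ℚP
open import Data.Rational.Unnormalised as ℚᵘ using (mkℚᵘ; *≡*)
import Data.Rational.Unnormalised.Properties as ℚᵘP
open import Data.Product using (_×_; Σ; _,_; proj₁; proj₂; ∃)
open import Data.Empty using (⊥-elim)
open import Data.Sum using (_⊎_; inj₁; inj₂; [_,_]′)
open import Data.Maybe using (nothing)
open import Level using (0ℓ)
open import Relation.Nullary using (¬_; yes; no)
open import Relation.Binary.PropositionalEquality
  using (_≡_; _≢_; refl; cong; cong₂; trans; sym; subst; subst₂; module ≡-Reasoning)
open import Tactic.RingSolver using (solve-∀)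
open import Tactic.RingSolver.Core.AlmostCommutativeRing using (AlmostCommutativeRing; fromCommutativeRing)

-- Rédei polynomials

ℚ-ring : AlmostCommutativeRing 0ℓ 0ℓ
ℚ-ring = fromCommutativeRing ℚP.+-*-commutativeRing (λ _ → nothing)

ι≡mkℚ : ∀ n → ι n ≡ mkℚ (+ n) 0 (Coprime.sym (1-coprimeTo n))
ι≡mkℚ n = ℚP.normalize-coprime (Coprime.sym (1-coprimeTo n))

toℚᵘ-ι : ∀ n → ℚ.toℚᵘ (ι n) ℚᵘ.≃ mkℚᵘ (+ n) 0
toℚᵘ-ι n rewrite ι≡mkℚ n = ℚᵘP.≃-refl

toℚᵘ-frac : ∀ a b → ℚ.toℚᵘ (frac a (suc b)) ℚᵘ.≃ mkℚᵘ (+ a) b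
toℚᵘ-frac a b = ℚP.toℚᵘ-fromℚᵘ (mkℚᵘ (+ a) b)

ι-homo-+ : ∀ a b → ι (a + b) ≡ ι a ℚ.+ ι b
ι-homo-+ a b = ℚP.toℚᵘ-injective (begin
  ℚ.toℚᵘ (ι (a + b))             ≈⟨ toℚᵘ-ι (a + b) ⟩
  mkℚᵘ (+ (a + b)) 0             ≈⟨ *≡* (cong (ℤ._* + 1) (ℤP.pos-+ a b)) ⟩
  mkℚᵘ (+ a ℤ.+ + b) 0           ≈⟨ *≡* (cross (+ a) (+ b)) ⟩
  mkℚᵘ (+ a) 0 ℚᵘ.+ mkℚᵘ (+ b) 0 ≈⟨ ℚᵘP.+-cong (toℚᵘ-ι a) (toℚᵘ-ι b) ⟨
  ℚ.toℚᵘ (ι a) ℚᵘ.+ ℚ.toℚᵘ (ι b) ≈⟨ ℚP.toℚᵘ-homo-+ (ι a) (ι b) ⟨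
  ℚ.toℚᵘ (ι a ℚ.+ ι b)           ∎)
  where
  open ℚᵘP.≃-Reasoning
  cross : ∀ x y → (x ℤ.+ y) ℤ.* + 1 ≡ (x ℤ.* + 1 ℤ.+ y ℤ.* + 1) ℤ.* + 1
  cross = ℤ-solve

ι-homo-* : ∀ a b → ι (a * b) ≡ ι a ℚ.* ι b
ι-homo-* a b = ℚP.toℚᵘ-injective (begin
  ℚ.toℚᵘ (ι (a * b))             ≈⟨ toℚᵘ-ι (a * b) ⟩
  mkℚᵘ (+ (a * b)) 0             ≈⟨ *≡* (cong (ℤ._* + 1) (ℤP.pos-* a b)) ⟩
  mkℚᵘ (+ a) 0 ℚᵘ.* mkℚᵘ (+ b) 0 ≈⟨ ℚᵘP.*-cong (toℚᵘ-ι a) (toℚᵘ-ι b) ⟨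
  ℚ.toℚᵘ (ι a) ℚᵘ.* ℚ.toℚᵘ (ι b) ≈⟨ ℚP.toℚᵘ-homo-* (ι a) (ι b) ⟨
  ℚ.toℚᵘ (ι a ℚ.* ι b)           ∎)
  where open ℚᵘP.≃-Reasoning

ι-injective : ∀ {a b} → ι a ≡ ι b → a ≡ b
ι-injective {a} {b} e rewrite ι≡mkℚ a | ι≡mkℚ b = ℤP.+-injective (cong ℚ.numerator e)

frac≡ι*frac1 : ∀ a b → frac a (suc b) ≡ ι a ℚ.* frac 1 (suc b)
frac≡ι*frac1 a b = ℚP.toℚᵘ-injective (begin
  ℚ.toℚᵘ (frac a (suc b))                 ≈⟨ toℚᵘ-frac a b ⟩
  mkℚᵘ (+ a) b                            ≈⟨ *≡* cross ⟩
  mkℚᵘ (+ a) 0 ℚᵘ.* mkℚᵘ (+ 1) b          ≈⟨ ℚᵘP.*-cong (toℚᵘ-ι a) (toℚᵘ-frac 1 b) ⟨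
  ℚ.toℚᵘ (ι a) ℚᵘ.* ℚ.toℚᵘ (frac 1 (suc b)) ≈⟨ ℚP.toℚᵘ-homo-* (ι a) (frac 1 (suc b)) ⟨
  ℚ.toℚᵘ (ι a ℚ.* frac 1 (suc b))         ∎)
  where
  open ℚᵘP.≃-Reasoning
  cross : + a ℤ.* + (1 * suc b) ≡ (+ a ℤ.* + 1) ℤ.* + suc b
  cross rewrite ℕP.*-identityˡ (suc b) = cong (ℤ._* + suc b) (sym (ℤP.*-identityʳ (+ a)))

frac1*ι≡1 : ∀ b → frac 1 (suc b) ℚ.* ι (suc b) ≡ 1ℚ
frac1*ι≡1 b = ℚP.toℚᵘ-injective (begin
  ℚ.toℚᵘ (frac 1 (suc b) ℚ.* ι (suc b))         ≈⟨ ℚP.toℚᵘ-homo-* (frac 1 (suc b)) (ι (suc b)) ⟩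
  ℚ.toℚᵘ (frac 1 (suc b)) ℚᵘ.* ℚ.toℚᵘ (ι (suc b)) ≈⟨ ℚᵘP.*-cong (toℚᵘ-frac 1 b) (toℚᵘ-ι (suc b)) ⟩
  mkℚᵘ (+ 1) b ℚᵘ.* mkℚᵘ (+ suc b) 0             ≈⟨ *≡* cross ⟩
  ℚᵘ.1ℚᵘ                                         ∎)
  where
  open ℚᵘP.≃-Reasoning
  cross : (+ 1 ℤ.* + suc b) ℤ.* + 1 ≡ + 1 ℤ.* + (suc b * 1)
  cross = ℤP.*-assoc (+ 1) (+ suc b) (+ 1)

sumTo-cong : ∀ B {f g : ℕ → ℚ} → (∀ k → f k ≡ g k) → sumTo B f ≡ sumTo B g
sumTo-cong zero    f≗g = f≗g 0
sumTo-cong (suc B) f≗g = cong₂ ℚ._+_ (sumTo-cong B f≗g) (f≗g (suc B))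

sumTo-+ : ∀ B (f g : ℕ → ℚ) → sumTo B (λ k → f k ℚ.+ g k) ≡ sumTo B f ℚ.+ sumTo B g
sumTo-+ zero    f g = refl
sumTo-+ (suc B) f g rewrite sumTo-+ B f g = interchange (sumTo B f) (sumTo B g) (f (suc B)) (g (suc B))
  where
  interchange : ∀ a b c e → a ℚ.+ b ℚ.+ (c ℚ.+ e) ≡ a ℚ.+ c ℚ.+ (b ℚ.+ e)
  interchange = solve-∀ ℚ-ring

sumTo-*ˡ : ∀ B c (f : ℕ → ℚ) → sumTo B (λ k → c ℚ.* f k) ≡ c ℚ.* sumTo B f
sumTo-*ˡ zero    c f = refl
sumTo-*ˡ (suc B) c f rewrite sumTo-*ˡ B c f = sym (ℚP.*-distribˡ-+ c (sumTo B f) (f (suc B)))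

sumTo-suc : ∀ B (f : ℕ → ℚ) → sumTo (suc B) f ≡ f 0 ℚ.+ sumTo B (λ k → f (suc k))
sumTo-suc zero    f = refl
sumTo-suc (suc B) f rewrite sumTo-suc B f = ℚP.+-assoc (f 0) _ _

sumTo-pad : ∀ {B B′} (f : ℕ → ℚ) → B ≤ B′ → (∀ k → B < k → f k ≡ 0ℚ) → sumTo B′ f ≡ sumTo B f
sumTo-pad {B} {B′} f B≤B′ vanish = begin
  sumTo B′ f                 ≡⟨ cong (λ t → sumTo t f) (ℕP.m∸n+n≡m B≤B′) ⟨
  sumTo (B′ ∸ B + B) f       ≡⟨ pad (B′ ∸ B) ⟩
  sumTo B f                  ∎
  where
  open ≡-Reasoning
  pad : ∀ j → sumTo (j + B) f ≡ sumTo B f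
  pad zero    = refl
  pad (suc j) rewrite pad j | vanish (suc (j + B)) (s≤s (ℕP.m≤n+m B j)) = ℚP.+-identityʳ _

double-suc : ∀ k → 2 * suc k ≡ suc (suc (2 * k))
double-suc k = ℕP.*-suc 2 k

⌊m/2⌋<k⇒m<2k : ∀ m k → ⌊ m /2⌋ < k → m < 2 * k
⌊m/2⌋<k⇒m<2k zero          (suc k) _       = s≤s z≤n
⌊m/2⌋<k⇒m<2k (suc zero)    (suc k) _       rewrite double-suc k = s≤s (s≤s z≤n)
⌊m/2⌋<k⇒m<2k (suc (suc m)) (suc k) (s≤s h) rewrite double-suc k = s≤s (s≤s (⌊m/2⌋<k⇒m<2k m k h))

ι-pascal : ∀ m j → ι (suc m C suc j) ≡ ι (m C j) ℚ.+ ι (m C suc j)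
ι-pascal m j = trans (cong ι (sym (nCk+nC[k+1]≡[n+1]C[k+1] m j))) (ι-homo-+ (m C j) (m C suc j))

-- N_m + D_m √d = (z + √d)^m; the recurrences below multiply by z + √d.
module RedeiRecurrence (d z : ℚ) where
  open ≡-Reasoning

  Nterm Dterm : ℕ → ℕ → ℚ
  Nterm m k = ι (m C (2 * k)) ℚ.* (d ^q k) ℚ.* (z ^q (m ∸ 2 * k))
  Dterm m k = ι (m C suc (2 * k)) ℚ.* (d ^q k) ℚ.* (z ^q (m ∸ suc (2 * k)))

  term-vanishes : ∀ c x y → c ≡ 0 → ι c ℚ.* x ℚ.* y ≡ 0ℚ
  term-vanishes c x y refl = trans (cong (ℚ._* y) (ℚP.*-zeroˡ x)) (ℚP.*-zeroˡ y)

  Nr-padded : ∀ m {B} → ⌊ m /2⌋ ≤ B → Nr m d z ≡ sumTo B (Nterm m)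
  Nr-padded m h = sym (sumTo-pad (Nterm m) h λ k lt →
    term-vanishes _ _ _ (k>n⇒nCk≡0 (⌊m/2⌋<k⇒m<2k m k lt)))

  Dr-padded : ∀ m {B} → ⌊ m /2⌋ ≤ B → Dr m d z ≡ sumTo B (Dterm m)
  Dr-padded m h = sym (sumTo-pad (Dterm m) h λ k lt →
    term-vanishes _ _ _ (k>n⇒nCk≡0 (ℕP.m<n⇒m<1+n (⌊m/2⌋<k⇒m<2k m k lt))))

  -- for j ≥ m the coefficient m C (j + 1) vanishes, which absorbs the truncated subtraction
  binomial-z-shift : ∀ m j → ι (m C suc j) ℚ.* (z ^q (m ∸ j)) ≡ z ℚ.* (ι (m C suc j) ℚ.* (z ^q (m ∸ suc j)))
  binomial-z-shift m j with j ℕP.<? m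
  ... | yes j<m rewrite ℕP.+-∸-assoc 1 j<m = swap (ι (m C suc j)) z (z ^q (m ∸ suc j))
    where
    swap : ∀ a b c → a ℚ.* (b ℚ.* c) ≡ b ℚ.* (a ℚ.* c)
    swap = solve-∀ ℚ-ring
  ... | no j≮m rewrite k>n⇒nCk≡0 (ℕP.≰⇒> j≮m) = begin
    0ℚ ℚ.* (z ^q (m ∸ j))           ≡⟨ ℚP.*-zeroˡ (z ^q (m ∸ j)) ⟩
    0ℚ                              ≡⟨ ℚP.*-zeroʳ z ⟨
    z ℚ.* 0ℚ                        ≡⟨ cong (z ℚ.*_) (ℚP.*-zeroˡ (z ^q (m ∸ suc j))) ⟨
    z ℚ.* (0ℚ ℚ.* (z ^q (m ∸ suc j))) ∎

  Nterm-suc-zero : ∀ m → Nterm (suc m) 0 ≡ z ℚ.* Nterm m 0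
  Nterm-suc-zero m = rearrange z (d ^q 0) (z ^q m)
    where
    rearrange : ∀ z a b → 1ℚ ℚ.* a ℚ.* (z ℚ.* b) ≡ z ℚ.* (1ℚ ℚ.* a ℚ.* b)
    rearrange = solve-∀ ℚ-ring

  Nterm-suc : ∀ m k → Nterm (suc m) (suc k) ≡ d ℚ.* Dterm m k ℚ.+ z ℚ.* Nterm m (suc k)
  Nterm-suc m k = begin
    Nterm (suc m) (suc k)
      ≡⟨ cong (λ t → ι (suc m C t) ℚ.* (d ℚ.* D) ℚ.* (z ^q (suc m ∸ t))) (double-suc k) ⟩
    ι (suc m C suc j) ℚ.* (d ℚ.* D) ℚ.* Z
      ≡⟨ cong (λ t → t ℚ.* (d ℚ.* D) ℚ.* Z) (ι-pascal m j) ⟩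
    (ι (m C j) ℚ.+ ι (m C suc j)) ℚ.* (d ℚ.* D) ℚ.* Z
      ≡⟨ distrib d (ι (m C j)) (ι (m C suc j)) D Z ⟩
    d ℚ.* Dterm m k ℚ.+ (d ℚ.* D) ℚ.* (ι (m C suc j) ℚ.* Z)
      ≡⟨ cong (λ t → d ℚ.* Dterm m k ℚ.+ (d ℚ.* D) ℚ.* t) (binomial-z-shift m j) ⟩
    d ℚ.* Dterm m k ℚ.+ (d ℚ.* D) ℚ.* (z ℚ.* (ι (m C suc j) ℚ.* Z′))
      ≡⟨ cong (d ℚ.* Dterm m k ℚ.+_) (regroup d z (ι (m C suc j)) D Z′) ⟩
    d ℚ.* Dterm m k ℚ.+ z ℚ.* (ι (m C suc j) ℚ.* (d ℚ.* D) ℚ.* Z′)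
      ≡⟨ cong (λ t → d ℚ.* Dterm m k ℚ.+ z ℚ.* (ι (m C t) ℚ.* (d ℚ.* D) ℚ.* (z ^q (m ∸ t)))) (double-suc k) ⟨
    d ℚ.* Dterm m k ℚ.+ z ℚ.* Nterm m (suc k) ∎
    where
    j = suc (2 * k)
    D = d ^q k
    Z = z ^q (m ∸ j)
    Z′ = z ^q (m ∸ suc j)
    distrib : ∀ d a b D Z → (a ℚ.+ b) ℚ.* (d ℚ.* D) ℚ.* Z ≡ d ℚ.* (a ℚ.* D ℚ.* Z) ℚ.+ (d ℚ.* D) ℚ.* (b ℚ.* Z)
    distrib = solve-∀ ℚ-ring
    regroup : ∀ d z b D Z′ → (d ℚ.* D) ℚ.* (z ℚ.* (b ℚ.* Z′)) ≡ z ℚ.* (b ℚ.* (d ℚ.* D) ℚ.* Z′)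
    regroup = solve-∀ ℚ-ring

  Dterm-suc : ∀ m k → Dterm (suc m) k ≡ Nterm m k ℚ.+ z ℚ.* Dterm m k
  Dterm-suc m k = begin
    Dterm (suc m) k
      ≡⟨ cong (λ t → t ℚ.* D ℚ.* Z) (ι-pascal m j) ⟩
    (ι (m C j) ℚ.+ ι (m C suc j)) ℚ.* D ℚ.* Z
      ≡⟨ distrib (ι (m C j)) (ι (m C suc j)) D Z ⟩
    Nterm m k ℚ.+ D ℚ.* (ι (m C suc j) ℚ.* Z)
      ≡⟨ cong (λ t → Nterm m k ℚ.+ D ℚ.* t) (binomial-z-shift m j) ⟩
    Nterm m k ℚ.+ D ℚ.* (z ℚ.* (ι (m C suc j) ℚ.* (z ^q (m ∸ suc j))))
      ≡⟨ cong (Nterm m k ℚ.+_) (regroup z (ι (m C suc j)) D (z ^q (m ∸ suc j))) ⟩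
    Nterm m k ℚ.+ z ℚ.* Dterm m k ∎
    where
    j = 2 * k
    D = d ^q k
    Z = z ^q (m ∸ j)
    distrib : ∀ a b D Z → (a ℚ.+ b) ℚ.* D ℚ.* Z ≡ a ℚ.* D ℚ.* Z ℚ.+ D ℚ.* (b ℚ.* Z)
    distrib = solve-∀ ℚ-ring
    regroup : ∀ z b D Z′ → D ℚ.* (z ℚ.* (b ℚ.* Z′)) ≡ z ℚ.* (b ℚ.* D ℚ.* Z′)
    regroup = solve-∀ ℚ-ring

  Nr-suc : ∀ m → Nr (suc m) d z ≡ z ℚ.* Nr m d z ℚ.+ d ℚ.* Dr m d z
  Nr-suc m = begin
    Nr (suc m) d z
      ≡⟨ Nr-padded (suc m) (ℕP.⌊n/2⌋≤n (suc m)) ⟩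
    sumTo (suc m) (Nterm (suc m))
      ≡⟨ sumTo-suc m (Nterm (suc m)) ⟩
    Nterm (suc m) 0 ℚ.+ sumTo m (λ k → Nterm (suc m) (suc k))
      ≡⟨ cong₂ ℚ._+_ (Nterm-suc-zero m) (sumTo-cong m (Nterm-suc m)) ⟩
    z ℚ.* Nterm m 0 ℚ.+ sumTo m (λ k → d ℚ.* Dterm m k ℚ.+ z ℚ.* Nterm m (suc k))
      ≡⟨ cong (z ℚ.* Nterm m 0 ℚ.+_) (trans (sumTo-+ m _ _)
           (cong₂ ℚ._+_ (sumTo-*ˡ m d (Dterm m)) (sumTo-*ˡ m z (λ k → Nterm m (suc k))))) ⟩
    z ℚ.* Nterm m 0 ℚ.+ (d ℚ.* sumTo m (Dterm m) ℚ.+ z ℚ.* sumTo m (λ k → Nterm m (suc k)))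
      ≡⟨ regroup d z (Nterm m 0) (sumTo m (Dterm m)) (sumTo m (λ k → Nterm m (suc k))) ⟩
    z ℚ.* (Nterm m 0 ℚ.+ sumTo m (λ k → Nterm m (suc k))) ℚ.+ d ℚ.* sumTo m (Dterm m)
      ≡⟨ cong₂ (λ x y → z ℚ.* x ℚ.+ d ℚ.* y)
           (trans (Nr-padded m (ℕP.m≤n⇒m≤1+n (ℕP.⌊n/2⌋≤n m))) (sumTo-suc m (Nterm m)))
           (Dr-padded m (ℕP.⌊n/2⌋≤n m)) ⟨
    z ℚ.* Nr m d z ℚ.+ d ℚ.* Dr m d z ∎
    where
    regroup : ∀ d z a b c → z ℚ.* a ℚ.+ (d ℚ.* b ℚ.+ z ℚ.* c) ≡ z ℚ.* (a ℚ.+ c) ℚ.+ d ℚ.* b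
    regroup = solve-∀ ℚ-ring

  Dr-suc : ∀ m → Dr (suc m) d z ≡ Nr m d z ℚ.+ z ℚ.* Dr m d z
  Dr-suc m = begin
    Dr (suc m) d z
      ≡⟨ Dr-padded (suc m) (ℕP.⌊n/2⌋≤n (suc m)) ⟩
    sumTo (suc m) (Dterm (suc m))
      ≡⟨ sumTo-cong (suc m) (Dterm-suc m) ⟩
    sumTo (suc m) (λ k → Nterm m k ℚ.+ z ℚ.* Dterm m k)
      ≡⟨ trans (sumTo-+ (suc m) _ _) (cong (sumTo (suc m) (Nterm m) ℚ.+_) (sumTo-*ˡ (suc m) z (Dterm m))) ⟩
    sumTo (suc m) (Nterm m) ℚ.+ z ℚ.* sumTo (suc m) (Dterm m)
      ≡⟨ cong₂ (λ x y → x ℚ.+ z ℚ.* y) (Nr-padded m ⌊m/2⌋≤1+m) (Dr-padded m ⌊m/2⌋≤1+m) ⟨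
    Nr m d z ℚ.+ z ℚ.* Dr m d z ∎
    where
    ⌊m/2⌋≤1+m = ℕP.m≤n⇒m≤1+n (ℕP.⌊n/2⌋≤n m)

  Nr-suc-suc : ∀ m → Nr (suc (suc m)) d z ≡ (z ℚ.* z ℚ.+ d) ℚ.* Nr m d z ℚ.+ (z ℚ.+ z) ℚ.* (d ℚ.* Dr m d z)
  Nr-suc-suc m = begin
    Nr (suc (suc m)) d z                                        ≡⟨ Nr-suc (suc m) ⟩
    z ℚ.* Nr (suc m) d z ℚ.+ d ℚ.* Dr (suc m) d z               ≡⟨ cong₂ (λ u v → z ℚ.* u ℚ.+ d ℚ.* v) (Nr-suc m) (Dr-suc m) ⟩
    z ℚ.* (z ℚ.* N ℚ.+ d ℚ.* D) ℚ.+ d ℚ.* (N ℚ.+ z ℚ.* D)       ≡⟨ collect z d N D ⟩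
    (z ℚ.* z ℚ.+ d) ℚ.* N ℚ.+ (z ℚ.+ z) ℚ.* (d ℚ.* D)          ∎
    where
    N = Nr m d z
    D = Dr m d z
    collect : ∀ z d N D → z ℚ.* (z ℚ.* N ℚ.+ d ℚ.* D) ℚ.+ d ℚ.* (N ℚ.+ z ℚ.* D)
                        ≡ (z ℚ.* z ℚ.+ d) ℚ.* N ℚ.+ (z ℚ.+ z) ℚ.* (d ℚ.* D)
    collect = solve-∀ ℚ-ring

  Dr-suc-suc : ∀ m → Dr (suc (suc m)) d z ≡ (z ℚ.+ z) ℚ.* Nr m d z ℚ.+ (z ℚ.* z ℚ.+ d) ℚ.* Dr m d z
  Dr-suc-suc m = begin
    Dr (suc (suc m)) d z                                        ≡⟨ Dr-suc (suc m) ⟩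
    Nr (suc m) d z ℚ.+ z ℚ.* Dr (suc m) d z                     ≡⟨ cong₂ (λ u v → u ℚ.+ z ℚ.* v) (Nr-suc m) (Dr-suc m) ⟩
    (z ℚ.* N ℚ.+ d ℚ.* D) ℚ.+ z ℚ.* (N ℚ.+ z ℚ.* D)             ≡⟨ collect z d N D ⟩
    (z ℚ.+ z) ℚ.* N ℚ.+ (z ℚ.* z ℚ.+ d) ℚ.* D                  ∎
    where
    N = Nr m d z
    D = Dr m d z
    collect : ∀ z d N D → (z ℚ.* N ℚ.+ d ℚ.* D) ℚ.+ z ℚ.* (N ℚ.+ z ℚ.* D)
                        ≡ (z ℚ.+ z) ℚ.* N ℚ.+ (z ℚ.* z ℚ.+ d) ℚ.* D
    collect = solve-∀ ℚ-ring

-- (x + y√d)ⁿ = X + Y√d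
pellPower : ℕ → ℕ → ℕ → ℕ → ℕ × ℕ
pellPower d x y zero    = 1 , 0
pellPower d x y (suc n) = x * X + d * (y * Y) , y * X + x * Y
  where
  X = proj₁ (pellPower d x y n)
  Y = proj₂ (pellPower d x y n)

pellPower-pos : ∀ {d x y} → 1 ≤ x → 1 ≤ y → ∀ n → 1 ≤ proj₁ (pellPower d x y n) × (1 ≤ n → 1 ≤ proj₂ (pellPower d x y n))
pellPower-pos         x≥1 y≥1 zero    = s≤s z≤n , λ ()
pellPower-pos {d} {x} {y} x≥1 y≥1 (suc n) =
  ℕP.≤-trans (ℕP.*-mono-≤ x≥1 X≥1) (ℕP.m≤m+n (x * X) _) ,
  λ _ → ℕP.≤-trans (ℕP.*-mono-≤ y≥1 X≥1) (ℕP.m≤m+n (y * X) _)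
  where
  X = proj₁ (pellPower d x y n)
  X≥1 = proj₁ (pellPower-pos x≥1 y≥1 n)

module RedeiAtPellPoint (dₙ x b : ℕ) (pell : x * x ≡ dₙ * (suc b * suc b) + 1) where
  open ≡-Reasoning

  y = suc b
  d = ι dₙ
  w = frac 1 y
  z = frac (x + 1) y
  X Y : ℕ → ℕ
  X n = proj₁ (pellPower dₙ x y n)
  Y n = proj₂ (pellPower dₙ x y n)

  -- c = 2(x + 1)/y², chosen so that z² + d = c x and 2z = c y, i.e. (z + √d)² = c (x + y√d)
  c : ℚ
  c = ι (2 * (x + 1)) ℚ.* w ℚ.* w

  w*y≡1 : w ℚ.* ι y ≡ 1ℚ
  w*y≡1 = frac1*ι≡1 b

  z≡ι*w : z ≡ ι (x + 1) ℚ.* w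
  z≡ι*w = frac≡ι*frac1 (x + 1) b

  pell-shifted : (x + 1) * (x + 1) + dₙ * (y * y) ≡ 2 * (x + 1) * x
  pell-shifted = begin
    (x + 1) * (x + 1) + dₙ * (y * y)   ≡⟨ expand x (dₙ * (y * y)) ⟩
    x * x + (dₙ * (y * y) + 1) + 2 * x ≡⟨ cong (λ t → x * x + t + 2 * x) pell ⟨
    x * x + x * x + 2 * x              ≡⟨ collect x ⟩
    2 * (x + 1) * x                    ∎
    where
    expand : ∀ x t → (x + 1) * (x + 1) + t ≡ x * x + (t + 1) + 2 * x
    expand = ℕ-solve
    collect : ∀ x → x * x + x * x + 2 * x ≡ 2 * (x + 1) * x
    collect = ℕ-solve

  ι-double : ∀ n → ι (2 * n) ≡ ι n ℚ.+ ι n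
  ι-double n = trans (ι-homo-+ n (n + 0)) (cong (λ t → ι n ℚ.+ ι t) (ℕP.+-identityʳ n))

  ι-pellForm : ∀ u v → ι (u * u + dₙ * (v * v)) ≡ ι u ℚ.* ι u ℚ.+ d ℚ.* (ι v ℚ.* ι v)
  ι-pellForm u v = trans (ι-homo-+ (u * u) (dₙ * (v * v)))
    (cong₂ ℚ._+_ (ι-homo-* u u) (trans (ι-homo-* dₙ (v * v)) (cong (d ℚ.*_) (ι-homo-* v v))))

  z²+d≡c*x : z ℚ.* z ℚ.+ d ≡ c ℚ.* ι x
  z²+d≡c*x = begin
    z ℚ.* z ℚ.+ d
      ≡⟨ cong₂ (λ u v → u ℚ.* u ℚ.+ v) z≡ι*w d≡d*[wy]² ⟩
    ι (x + 1) ℚ.* w ℚ.* (ι (x + 1) ℚ.* w) ℚ.+ d ℚ.* (w ℚ.* ι y ℚ.* (w ℚ.* ι y))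
      ≡⟨ factor (ι (x + 1)) w d (ι y) ⟩
    w ℚ.* w ℚ.* (ι (x + 1) ℚ.* ι (x + 1) ℚ.+ d ℚ.* (ι y ℚ.* ι y))
      ≡⟨ cong (w ℚ.* w ℚ.*_) (ι-pellForm (x + 1) y) ⟨
    w ℚ.* w ℚ.* ι ((x + 1) * (x + 1) + dₙ * (y * y))
      ≡⟨ cong (λ t → w ℚ.* w ℚ.* ι t) pell-shifted ⟩
    w ℚ.* w ℚ.* ι (2 * (x + 1) * x)
      ≡⟨ cong (w ℚ.* w ℚ.*_) (ι-homo-* (2 * (x + 1)) x) ⟩
    w ℚ.* w ℚ.* (ι (2 * (x + 1)) ℚ.* ι x)
      ≡⟨ reorder w (ι (2 * (x + 1))) (ι x) ⟩
    c ℚ.* ι x ∎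
    where
    d≡d*[wy]² : d ≡ d ℚ.* (w ℚ.* ι y ℚ.* (w ℚ.* ι y))
    d≡d*[wy]² = sym (trans (cong (λ v → d ℚ.* (v ℚ.* v)) w*y≡1) (ℚP.*-identityʳ d))
    factor : ∀ a w d y → a ℚ.* w ℚ.* (a ℚ.* w) ℚ.+ d ℚ.* (w ℚ.* y ℚ.* (w ℚ.* y))
                       ≡ w ℚ.* w ℚ.* (a ℚ.* a ℚ.+ d ℚ.* (y ℚ.* y))
    factor = solve-∀ ℚ-ring
    reorder : ∀ w a x → w ℚ.* w ℚ.* (a ℚ.* x) ≡ a ℚ.* w ℚ.* w ℚ.* x
    reorder = solve-∀ ℚ-ring

  z+z≡c*y : z ℚ.+ z ≡ c ℚ.* ι y
  z+z≡c*y = begin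
    z ℚ.+ z                                       ≡⟨ cong (λ u → u ℚ.+ u) z≡ι*w ⟩
    ι (x + 1) ℚ.* w ℚ.+ ι (x + 1) ℚ.* w           ≡⟨ collect (ι (x + 1)) w ⟩
    (ι (x + 1) ℚ.+ ι (x + 1)) ℚ.* w ℚ.* 1ℚ        ≡⟨ cong₂ (λ a t → a ℚ.* w ℚ.* t) (ι-double (x + 1)) w*y≡1 ⟨
    ι (2 * (x + 1)) ℚ.* w ℚ.* (w ℚ.* ι y)         ≡⟨ ℚP.*-assoc (ι (2 * (x + 1)) ℚ.* w) w (ι y) ⟨
    c ℚ.* ι y                                     ∎
    where
    collect : ∀ a w → a ℚ.* w ℚ.+ a ℚ.* w ≡ (a ℚ.+ a) ℚ.* w ℚ.* 1ℚ
    collect = solve-∀ ℚ-ring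

  c*y²≡2[x+1] : c ℚ.* ι (y * y) ≡ ι (2 * (x + 1))
  c*y²≡2[x+1] = begin
    c ℚ.* ι (y * y)                                         ≡⟨ cong (c ℚ.*_) (ι-homo-* y y) ⟩
    c ℚ.* (ι y ℚ.* ι y)                                     ≡⟨ regroup (ι (2 * (x + 1))) w (ι y) ⟩
    ι (2 * (x + 1)) ℚ.* (w ℚ.* ι y) ℚ.* (w ℚ.* ι y)         ≡⟨ cong (λ t → ι (2 * (x + 1)) ℚ.* t ℚ.* t) w*y≡1 ⟩
    ι (2 * (x + 1)) ℚ.* 1ℚ ℚ.* 1ℚ                           ≡⟨ trans (ℚP.*-identityʳ _) (ℚP.*-identityʳ _) ⟩
    ι (2 * (x + 1))                                         ∎
    where
    regroup : ∀ a w y → a ℚ.* w ℚ.* w ℚ.* (y ℚ.* y) ≡ a ℚ.* (w ℚ.* y) ℚ.* (w ℚ.* y)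
    regroup = solve-∀ ℚ-ring

  ι-X-suc : ∀ n → ι (X (suc n)) ≡ ι x ℚ.* ι (X n) ℚ.+ d ℚ.* (ι y ℚ.* ι (Y n))
  ι-X-suc n = trans (ι-homo-+ (x * X n) (dₙ * (y * Y n)))
    (cong₂ ℚ._+_ (ι-homo-* x (X n)) (trans (ι-homo-* dₙ (y * Y n)) (cong (d ℚ.*_) (ι-homo-* y (Y n)))))

  ι-Y-suc : ∀ n → ι (Y (suc n)) ≡ ι y ℚ.* ι (X n) ℚ.+ ι x ℚ.* ι (Y n)
  ι-Y-suc n = trans (ι-homo-+ (y * X n) (x * Y n)) (cong₂ ℚ._+_ (ι-homo-* y (X n)) (ι-homo-* x (Y n)))

  open RedeiRecurrence d z using (Nr-suc-suc; Dr-suc-suc)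

  Nr-Dr-pellPower : ∀ n → (Nr (2 * n) d z ≡ c ^q n ℚ.* ι (X n)) × (Dr (2 * n) d z ≡ c ^q n ℚ.* ι (Y n))
  Nr-Dr-pellPower zero    = refl , refl
  Nr-Dr-pellPower (suc n) = Nr-step , Dr-step
    where
    N = Nr (2 * n) d z
    D = Dr (2 * n) d z
    K = c ^q n
    IH = Nr-Dr-pellPower n
    Nr-step : Nr (2 * suc n) d z ≡ c ^q suc n ℚ.* ι (X (suc n))
    Nr-step = begin
      Nr (2 * suc n) d z
        ≡⟨ cong (λ t → Nr t d z) (double-suc n) ⟩
      Nr (suc (suc (2 * n))) d z
        ≡⟨ Nr-suc-suc (2 * n) ⟩
      (z ℚ.* z ℚ.+ d) ℚ.* N ℚ.+ (z ℚ.+ z) ℚ.* (d ℚ.* D)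
        ≡⟨ cong₂ (λ u v → u ℚ.* N ℚ.+ v ℚ.* (d ℚ.* D)) z²+d≡c*x z+z≡c*y ⟩
      c ℚ.* ι x ℚ.* N ℚ.+ c ℚ.* ι y ℚ.* (d ℚ.* D)
        ≡⟨ cong₂ (λ u v → c ℚ.* ι x ℚ.* u ℚ.+ c ℚ.* ι y ℚ.* (d ℚ.* v)) (proj₁ IH) (proj₂ IH) ⟩
      c ℚ.* ι x ℚ.* (K ℚ.* ι (X n)) ℚ.+ c ℚ.* ι y ℚ.* (d ℚ.* (K ℚ.* ι (Y n)))
        ≡⟨ factor c K (ι x) (ι (X n)) (ι y) d (ι (Y n)) ⟩
      c ℚ.* K ℚ.* (ι x ℚ.* ι (X n) ℚ.+ d ℚ.* (ι y ℚ.* ι (Y n)))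
        ≡⟨ cong (c ℚ.* K ℚ.*_) (ι-X-suc n) ⟨
      c ^q suc n ℚ.* ι (X (suc n)) ∎
      where
      factor : ∀ c K x X y d Y → c ℚ.* x ℚ.* (K ℚ.* X) ℚ.+ c ℚ.* y ℚ.* (d ℚ.* (K ℚ.* Y))
                               ≡ c ℚ.* K ℚ.* (x ℚ.* X ℚ.+ d ℚ.* (y ℚ.* Y))
      factor = solve-∀ ℚ-ring
    Dr-step : Dr (2 * suc n) d z ≡ c ^q suc n ℚ.* ι (Y (suc n))
    Dr-step = begin
      Dr (2 * suc n) d z
        ≡⟨ cong (λ t → Dr t d z) (double-suc n) ⟩
      Dr (suc (suc (2 * n))) d z
        ≡⟨ Dr-suc-suc (2 * n) ⟩
      (z ℚ.+ z) ℚ.* N ℚ.+ (z ℚ.* z ℚ.+ d) ℚ.* D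
        ≡⟨ cong₂ (λ u v → u ℚ.* N ℚ.+ v ℚ.* D) z+z≡c*y z²+d≡c*x ⟩
      c ℚ.* ι y ℚ.* N ℚ.+ c ℚ.* ι x ℚ.* D
        ≡⟨ cong₂ (λ u v → c ℚ.* ι y ℚ.* u ℚ.+ c ℚ.* ι x ℚ.* v) (proj₁ IH) (proj₂ IH) ⟩
      c ℚ.* ι y ℚ.* (K ℚ.* ι (X n)) ℚ.+ c ℚ.* ι x ℚ.* (K ℚ.* ι (Y n))
        ≡⟨ factor c K (ι x) (ι (X n)) (ι y) (ι (Y n)) ⟩
      c ℚ.* K ℚ.* (ι y ℚ.* ι (X n) ℚ.+ ι x ℚ.* ι (Y n))
        ≡⟨ cong (c ℚ.* K ℚ.*_) (ι-Y-suc n) ⟨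
      c ^q suc n ℚ.* ι (Y (suc n)) ∎
      where
      factor : ∀ c K x X y Y → c ℚ.* y ℚ.* (K ℚ.* X) ℚ.+ c ℚ.* x ℚ.* (K ℚ.* Y)
                             ≡ c ℚ.* K ℚ.* (y ℚ.* X ℚ.+ x ℚ.* Y)
      factor = solve-∀ ℚ-ring

  Nr*Y≡X*Dr : ∀ n → Nr (2 * n) d z ℚ.* ι (Y n) ≡ ι (X n) ℚ.* Dr (2 * n) d z
  Nr*Y≡X*Dr n = begin
    Nr (2 * n) d z ℚ.* ι (Y n)          ≡⟨ cong (ℚ._* ι (Y n)) (proj₁ (Nr-Dr-pellPower n)) ⟩
    c ^q n ℚ.* ι (X n) ℚ.* ι (Y n)      ≡⟨ swap (c ^q n) (ι (X n)) (ι (Y n)) ⟩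
    ι (X n) ℚ.* (c ^q n ℚ.* ι (Y n))    ≡⟨ cong (ι (X n) ℚ.*_) (proj₂ (Nr-Dr-pellPower n)) ⟨
    ι (X n) ℚ.* Dr (2 * n) d z          ∎
    where
    swap : ∀ K X Y → K ℚ.* X ℚ.* Y ≡ X ℚ.* (K ℚ.* Y)
    swap = solve-∀ ℚ-ring

  cⁿ*y²ⁿ≡[2x+2]ⁿ : ∀ n → c ^q n ℚ.* (ι (y * y) ^q n) ≡ ι ((2 * (x + 1)) ^ n)
  cⁿ*y²ⁿ≡[2x+2]ⁿ zero    = refl
  cⁿ*y²ⁿ≡[2x+2]ⁿ (suc n) = begin
    c ℚ.* c ^q n ℚ.* (ι (y * y) ℚ.* ι (y * y) ^q n)        ≡⟨ interchange c (c ^q n) (ι (y * y)) (ι (y * y) ^q n) ⟩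
    c ℚ.* ι (y * y) ℚ.* (c ^q n ℚ.* (ι (y * y) ^q n))      ≡⟨ cong₂ ℚ._*_ c*y²≡2[x+1] (cⁿ*y²ⁿ≡[2x+2]ⁿ n) ⟩
    ι (2 * (x + 1)) ℚ.* ι ((2 * (x + 1)) ^ n)              ≡⟨ ι-homo-* (2 * (x + 1)) ((2 * (x + 1)) ^ n) ⟨
    ι ((2 * (x + 1)) ^ suc n)                              ∎
    where
    interchange : ∀ a b c e → a ℚ.* b ℚ.* (c ℚ.* e) ≡ a ℚ.* c ℚ.* (b ℚ.* e)
    interchange = solve-∀ ℚ-ring

  Dr≢0 : ∀ n → 1 ≤ Y n → Dr (2 * n) d z ≢ 0ℚ
  Dr≢0 n Yₙ≥1 D≡0 = ℕP.<⇒≢ positive (sym (ι-injective scaled-D≡0))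
    where
    A = 2 * (x + 1)
    instance
      A≢0 : ℕ.NonZero A
      A≢0 = ℕ.>-nonZero (ℕP.*-monoʳ-< 2 (ℕP.m≤n+m 1 x))
    positive : 0 < A ^ n * Y n
    positive = ℕP.*-mono-≤ (ℕP.m^n>0 A n) Yₙ≥1
    scaled-D≡0 : ι (A ^ n * Y n) ≡ ι 0
    scaled-D≡0 = begin
      ι (A ^ n * Y n)                                  ≡⟨ ι-homo-* (A ^ n) (Y n) ⟩
      ι (A ^ n) ℚ.* ι (Y n)                            ≡⟨ cong (ℚ._* ι (Y n)) (cⁿ*y²ⁿ≡[2x+2]ⁿ n) ⟨
      c ^q n ℚ.* (ι (y * y) ^q n) ℚ.* ι (Y n)          ≡⟨ swap (c ^q n) (ι (y * y) ^q n) (ι (Y n)) ⟩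
      c ^q n ℚ.* ι (Y n) ℚ.* (ι (y * y) ^q n)          ≡⟨ cong (ℚ._* (ι (y * y) ^q n)) (proj₂ (Nr-Dr-pellPower n)) ⟨
      Dr (2 * n) d z ℚ.* (ι (y * y) ^q n)              ≡⟨ cong (ℚ._* (ι (y * y) ^q n)) D≡0 ⟩
      0ℚ ℚ.* (ι (y * y) ^q n)                          ≡⟨ ℚP.*-zeroˡ (ι (y * y) ^q n) ⟩
      ι 0                                              ∎
      where
      swap : ∀ K P Y → K ℚ.* P ℚ.* Y ≡ K ℚ.* Y ℚ.* P
      swap = solve-∀ ℚ-ring

-- The continued fraction algorithm for √d

isqrtAux-sq≤ : ∀ d a → isqrtAux d a * isqrtAux d a ≤ d
isqrtAux-sq≤ d zero    = z≤n
isqrtAux-sq≤ d (suc a) with suc a * suc a ≤? d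
... | yes a²≤d = a²≤d
... | no  _    = isqrtAux-sq≤ d a

isqrtAux-greatest : ∀ d a s → s ≤ a → s * s ≤ d → s ≤ isqrtAux d a
isqrtAux-greatest d zero    s s≤a s²≤d = s≤a
isqrtAux-greatest d (suc a) s s≤a s²≤d with suc a * suc a ≤? d
... | yes _ = s≤a
... | no [1+a]²≰d with ℕP.m≤n⇒m<n∨m≡n s≤a
...   | inj₁ s<1+a = isqrtAux-greatest d a s (ℕP.≤-pred s<1+a) s²≤d
...   | inj₂ refl  = ⊥-elim ([1+a]²≰d s²≤d)

<[1+isqrt]² : ∀ d → d < suc (isqrt d) * suc (isqrt d)
<[1+isqrt]² d with d ℕP.<? suc (isqrt d) * suc (isqrt d)
... | yes d<[1+r]² = d<[1+r]²
... | no  d≮[1+r]² = ⊥-elim (ℕP.<-irrefl refl (isqrtAux-greatest d d (suc r) 1+r≤d [1+r]²≤d))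
  where
  r = isqrt d
  [1+r]²≤d = ℕP.≮⇒≥ d≮[1+r]²
  1+r≤d = ℕP.≤-trans (ℕP.m≤m*n (suc r) (suc r)) [1+r]²≤d

sq-mono-≤ : ∀ {x y} → x ≤ y → x * x ≤ y * y
sq-mono-≤ x≤y = ℕP.*-mono-≤ x≤y x≤y

sq-cancel-≤ : ∀ x y → x * x ≤ y * y → x ≤ y
sq-cancel-≤ x y x²≤y² = ℕP.≮⇒≥ λ y<x → ℕP.<⇒≱ (ℕP.*-mono-< y<x y<x) x²≤y²

ℤ-norm : ∀ x y z {w} → x * x + y * z ≡ w → + x ℤ.* + x ℤ.+ + y ℤ.* + z ≡ + w
ℤ-norm x y z e =
  trans (cong₂ ℤ._+_ (sym (ℤP.pos-* x x)) (sym (ℤP.pos-* y z))) (trans (sym (ℤP.pos-+ (x * x) (y * z))) (cong +_ e))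

ℤ-sum : ∀ x y {z} → x + y ≡ z → + x ℤ.+ + y ≡ + z
ℤ-sum x y e = trans (sym (ℤP.pos-+ x y)) (cong +_ e)

natural-cofactor : ∀ {q c d} (T : ℤ) → q < d → + q ℤ.+ + suc c ℤ.* T ≡ + d → ∃ λ t → q + suc c * t ≡ d
natural-cofactor {q} {c} (+ t) _ e = t , ℤP.+-injective (trans (ℤP.pos-+ q (suc c * t))
  (trans (cong (λ u → + q ℤ.+ u) (ℤP.pos-* (suc c) t)) e))
natural-cofactor {q} {c} {d} -[1+ t ] q<d e = ⊥-elim (ℕP.<⇒≱ q<d (ℕP.≤-trans (ℕP.m≤m+n d P) (ℕP.≤-reflexive (sym q≡d+P))))
  where
  P = suc c * suc t
  q≡d+P : q ≡ d + P
  q≡d+P = ℤP.+-injective (begin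
    + q                                  ≡⟨ shift (+ q) (+ suc c) (+ suc t) ⟩
    + q ℤ.+ + suc c ℤ.* -[1+ t ] ℤ.+ + suc c ℤ.* + suc t ≡⟨ cong₂ ℤ._+_ e (sym (ℤP.pos-* (suc c) (suc t))) ⟩
    + d ℤ.+ + P                          ≡⟨ ℤP.pos-+ d P ⟨
    + (d + P)                            ∎)
    where
    open ≡-Reasoning
    shift : ∀ q c t → q ≡ q ℤ.+ c ℤ.* ℤ.- t ℤ.+ c ℤ.* t
    shift = ℤ-solve

-- The state (m, c, c′) encodes the complete quotient (m + √d)/c, where c′ = (d − m²)/c.
record Reduced (d r m c c′ : ℕ) : Set where
  field
    c≥1   : 1 ≤ c
    m≤r   : m ≤ r
    norm  : m * m + c * c′ ≡ d
    c≤r+m : c ≤ r + m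

record Step (d r m c a m′ c″ : ℕ) : Set where
  field
    a*c≤m+r  : a * c ≤ m + r
    a≥1      : 1 ≤ a
    m′+m≡a*c : m′ + m ≡ a * c
    r<m′+c   : r < m′ + c
    reduced  : Reduced d r m′ c″ c
    r<m′+c″  : r < m′ + c″

next-norm-ℤ : ∀ {d m m′ a c c′} → m′ + m ≡ a * c → m * m + c * c′ ≡ d →
              + (m′ * m′) ℤ.+ + c ℤ.* (+ c′ ℤ.+ + a ℤ.* (+ m ℤ.- + m′)) ≡ + d
next-norm-ℤ {d} {m} {m′} {a} {c} {c′} m′+m≡a*c norm = begin
  + (m′ * m′) ℤ.+ + c ℤ.* (+ c′ ℤ.+ + a ℤ.* (+ m ℤ.- + m′))
    ≡⟨ cong (λ u → u ℤ.+ + c ℤ.* (+ c′ ℤ.+ + a ℤ.* (+ m ℤ.- + m′))) (ℤP.pos-* m′ m′) ⟩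
  + m′ ℤ.* + m′ ℤ.+ + c ℤ.* (+ c′ ℤ.+ + a ℤ.* (+ m ℤ.- + m′))
    ≡⟨ expand (+ m′) (+ m) (+ a) (+ c) (+ c′) ⟩
  + m′ ℤ.* + m′ ℤ.+ + c ℤ.* + c′ ℤ.+ (+ a ℤ.* + c) ℤ.* (+ m ℤ.- + m′)
    ≡⟨ cong (λ u → + m′ ℤ.* + m′ ℤ.+ + c ℤ.* + c′ ℤ.+ u ℤ.* (+ m ℤ.- + m′))
         (trans (ℤ-sum m′ m m′+m≡a*c) (ℤP.pos-* a c)) ⟨
  + m′ ℤ.* + m′ ℤ.+ + c ℤ.* + c′ ℤ.+ (+ m′ ℤ.+ + m) ℤ.* (+ m ℤ.- + m′)
    ≡⟨ difference-of-squares (+ m′) (+ m) (+ c) (+ c′) ⟩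
  + m ℤ.* + m ℤ.+ + c ℤ.* + c′
    ≡⟨ ℤ-norm m c c′ norm ⟩
  + d ∎
  where
  open ≡-Reasoning
  expand : ∀ x y a c c′ → x ℤ.* x ℤ.+ c ℤ.* (c′ ℤ.+ a ℤ.* (y ℤ.- x)) ≡ x ℤ.* x ℤ.+ c ℤ.* c′ ℤ.+ (a ℤ.* c) ℤ.* (y ℤ.- x)
  expand = ℤ-solve
  difference-of-squares : ∀ x y c c′ → x ℤ.* x ℤ.+ c ℤ.* c′ ℤ.+ (x ℤ.+ y) ℤ.* (y ℤ.- x) ≡ y ℤ.* y ℤ.+ c ℤ.* c′
  difference-of-squares = ℤ-solve

n<[n/c]*c+c : ∀ n c .{{_ : ℕ.NonZero c}} → n < n / c * c + c
n<[n/c]*c+c n c = begin-strict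
  n                 ≡⟨ m≡m%n+[m/n]*n n c ⟩
  n % c + n / c * c <⟨ ℕP.+-monoˡ-< (n / c * c) (m%n<n n c) ⟩
  c + n / c * c     ≡⟨ ℕP.+-comm c (n / c * c) ⟩
  n / c * c + c     ∎
  where open ℕP.≤-Reasoning

next-numerator : ∀ {d r m c c′ a} → Reduced d r m c c′ → 1 ≤ a → a * c ≤ m + r → m + r < a * c + c →
                 let m′ = a * c ∸ m in m′ + m ≡ a * c × m′ ≤ r × r < m′ + c × c ≤ r + m′
next-numerator {d} {r} {m} {c} {c′} {a} state a≥1 a*c≤m+r m+r<a*c+c =
  m′+m≡a*c , m′≤r , r<m′+c , c≤r+m′
  where
  open Reduced state
  open ℕP.≤-Reasoning
  m′ = a * c ∸ m
  c≤a*c : c ≤ a * c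
  c≤a*c = ℕP.≤-trans (ℕP.≤-reflexive (sym (ℕP.*-identityˡ c))) (ℕP.*-monoˡ-≤ c a≥1)
  m≤a*c : m ≤ a * c
  m≤a*c with c ℕP.≤? r
  ... | yes c≤r = ℕP.<⇒≤ (ℕP.+-cancelʳ-< c m (a * c) (ℕP.≤-<-trans (ℕP.+-monoʳ-≤ m c≤r) m+r<a*c+c))
  ... | no  c≰r = ℕP.≤-trans m≤r (ℕP.≤-trans (ℕP.<⇒≤ (ℕP.≰⇒> c≰r)) c≤a*c)
  m′+m≡a*c : m′ + m ≡ a * c
  m′+m≡a*c = ℕP.m∸n+n≡m m≤a*c
  m′≤r : m′ ≤ r
  m′≤r = ℕP.+-cancelʳ-≤ m m′ r (begin
    m′ + m   ≡⟨ m′+m≡a*c ⟩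
    a * c    ≤⟨ a*c≤m+r ⟩
    m + r    ≡⟨ ℕP.+-comm m r ⟩
    r + m    ∎)
  r<m′+c : r < m′ + c
  r<m′+c = ℕP.+-cancelʳ-< m r (m′ + c) (begin-strict
    r + m        ≡⟨ ℕP.+-comm r m ⟩
    m + r        <⟨ m+r<a*c+c ⟩
    a * c + c    ≡⟨ cong (_+ c) m′+m≡a*c ⟨
    m′ + m + c   ≡⟨ swap m′ m c ⟩
    m′ + c + m   ∎)
    where
    swap : ∀ x y z → x + y + z ≡ x + z + y
    swap = ℕ-solve
  c≤r+m′ : c ≤ r + m′
  c≤r+m′ = ℕP.+-cancelʳ-≤ m c (r + m′) (begin
    c + m        ≤⟨ ℕP.+-monoˡ-≤ m c≤a*c ⟩
    a * c + m    ≡⟨ cong (_+ m) m′+m≡a*c ⟨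
    m′ + m + m   ≤⟨ ℕP.+-monoʳ-≤ (m′ + m) m≤r ⟩
    m′ + m + r   ≡⟨ rotate m′ m r ⟩
    r + m′ + m   ∎)
    where
    rotate : ∀ x y z → x + y + z ≡ z + x + y
    rotate = ℕ-solve

module _ {d r : ℕ} (r²<d : r * r < d) (d<[1+r]² : d < suc r * suc r) where

  next-denominator : ∀ {m′ c t} → m′ ≤ r → r < m′ + c → c ≤ r + m′ → m′ * m′ + c * t ≡ d →
                     1 ≤ t × t ≤ r + m′ × r < m′ + t
  next-denominator {m′} {c} {t} m′≤r r<m′+c c≤r+m′ m′²+c*t≡d = t≥1 , t≤r+m′ , r<m′+t
    where
    open ℕP.≤-Reasoning
    m′²<d : m′ * m′ < d
    m′²<d = ℕP.≤-<-trans (sq-mono-≤ m′≤r) r²<d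
    t≥1 : 1 ≤ t
    t≥1 = ℕP.≮⇒≥ λ t<1 → ℕP.<⇒≢ m′²<d (begin-equality
      m′ * m′            ≡⟨ ℕP.+-identityʳ (m′ * m′) ⟨
      m′ * m′ + 0        ≡⟨ cong (λ u → m′ * m′ + u) (ℕP.*-zeroʳ c) ⟨
      m′ * m′ + c * 0    ≡⟨ cong (λ u → m′ * m′ + c * u) (ℕP.n<1⇒n≡0 t<1) ⟨
      m′ * m′ + c * t    ≡⟨ m′²+c*t≡d ⟩
      d                  ∎)
    -- with s = r + 1 − m′ ≤ c, (r + 1)² = m′² + s (s + 2m′) would be at most m′² + c t = d
    t≤r+m′ : t ≤ r + m′
    t≤r+m′ = ℕP.≮⇒≥ λ r+m′<t → ℕP.<-irrefl refl (begin-strict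
      suc r * suc r                   ≡⟨ cong (λ u → u * u) s+m′≡1+r ⟨
      (s + m′) * (s + m′)             ≡⟨ expand s m′ ⟩
      m′ * m′ + s * (s + m′ + m′)     ≤⟨ ℕP.+-monoʳ-≤ (m′ * m′) (ℕP.*-mono-≤ s≤c (s+2m′≤t r+m′<t)) ⟩
      m′ * m′ + c * t                 ≡⟨ m′²+c*t≡d ⟩
      d                               <⟨ d<[1+r]² ⟩
      suc r * suc r                   ∎)
      where
      s = suc r ∸ m′
      s+m′≡1+r : s + m′ ≡ suc r
      s+m′≡1+r = ℕP.m∸n+n≡m (ℕP.m≤n⇒m≤1+n m′≤r)
      s≤c : s ≤ c
      s≤c = ℕP.+-cancelʳ-≤ m′ s c (ℕP.≤-trans (ℕP.≤-reflexive s+m′≡1+r)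
              (ℕP.≤-trans r<m′+c (ℕP.≤-reflexive (ℕP.+-comm m′ c))))
      s+2m′≤t : r + m′ < t → s + m′ + m′ ≤ t
      s+2m′≤t = ℕP.≤-trans (ℕP.≤-reflexive (cong (_+ m′) s+m′≡1+r))
      expand : ∀ s m → (s + m) * (s + m) ≡ m * m + s * (s + m + m)
      expand = ℕ-solve
    -- with e = r − m′, c ≤ e + 2m′ gives m′² + e c ≤ r² < d = m′² + t c
    r<m′+t : r < m′ + t
    r<m′+t = ℕP.≤-trans (ℕP.≤-reflexive (cong suc (trans (sym e+m′≡r) (ℕP.+-comm e m′)))) (ℕP.+-monoʳ-< m′ e<t)
      where
      e = r ∸ m′
      e+m′≡r : e + m′ ≡ r
      e+m′≡r = ℕP.m∸n+n≡m m′≤r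
      e<t : e < t
      e<t = ℕP.*-cancelʳ-< c e t (ℕP.+-cancelˡ-< (m′ * m′) (e * c) (t * c) (begin-strict
        m′ * m′ + e * c            ≤⟨ ℕP.+-monoʳ-≤ (m′ * m′) (ℕP.*-monoʳ-≤ e
                                        (ℕP.≤-trans c≤r+m′ (ℕP.≤-reflexive (cong (_+ m′) (sym e+m′≡r))))) ⟩
        m′ * m′ + e * (e + m′ + m′) ≡⟨ expand e m′ ⟩
        (e + m′) * (e + m′)        ≡⟨ cong (λ u → u * u) e+m′≡r ⟩
        r * r                      <⟨ r²<d ⟩
        d                          ≡⟨ m′²+c*t≡d ⟨
        m′ * m′ + c * t            ≡⟨ cong (_+_ (m′ * m′)) (ℕP.*-comm c t) ⟩
        m′ * m′ + t * c            ∎))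
        where
        expand : ∀ s m → m * m + s * (s + m + m) ≡ (s + m) * (s + m)
        expand = ℕ-solve

  step : ∀ {m c c′} → Reduced d r m c c′ →
         let a = (m + r) div c; m′ = a * c ∸ m in Step d r m c a m′ ((d ∸ m′ * m′) div c)
  step {m} {suc c₀} {c′} state = record
    { a*c≤m+r = a*c≤m+r ; a≥1 = a≥1 ; m′+m≡a*c = m′+m≡a*c ; r<m′+c = r<m′+c
    ; reduced = subst (λ u → Reduced d r m′ u c) (sym c″≡t)
                  (record { c≥1 = t≥1 ; m≤r = m′≤r ; norm = m′²+t*c≡d ; c≤r+m = t≤r+m′ })
    ; r<m′+c″ = subst (λ u → r < m′ + u) (sym c″≡t) r<m′+t }
    where
    open Reduced state using (c≤r+m; norm)
    c = suc c₀
    a = (m + r) / c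
    m′ = a * c ∸ m
    a*c≤m+r : a * c ≤ m + r
    a*c≤m+r = m/n*n≤m (m + r) c
    a≥1 : 1 ≤ a
    a≥1 = m≥n⇒m/n>0 (ℕP.≤-trans c≤r+m (ℕP.≤-reflexive (ℕP.+-comm r m)))
    numerator = next-numerator state a≥1 a*c≤m+r (n<[n/c]*c+c (m + r) c)
    m′+m≡a*c : m′ + m ≡ a * c
    m′+m≡a*c = proj₁ numerator
    m′≤r : m′ ≤ r
    m′≤r = proj₁ (proj₂ numerator)
    r<m′+c : r < m′ + c
    r<m′+c = proj₁ (proj₂ (proj₂ numerator))
    c≤r+m′ : c ≤ r + m′
    c≤r+m′ = proj₂ (proj₂ (proj₂ numerator))
    cofactor : ∃ λ t → m′ * m′ + c * t ≡ d
    cofactor = natural-cofactor {c = c₀} (+ c′ ℤ.+ + a ℤ.* (+ m ℤ.- + m′)) (ℕP.≤-<-trans (sq-mono-≤ m′≤r) r²<d)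
                 (next-norm-ℤ {d} {m} {m′} {a} {c} {c′} m′+m≡a*c norm)
    t : ℕ
    t = proj₁ cofactor
    m′²+c*t≡d : m′ * m′ + c * t ≡ d
    m′²+c*t≡d = proj₂ cofactor
    m′²+t*c≡d : m′ * m′ + t * c ≡ d
    m′²+t*c≡d = trans (cong (_+_ (m′ * m′)) (ℕP.*-comm t c)) m′²+c*t≡d
    c″≡t : (d ∸ m′ * m′) / c ≡ t
    c″≡t = begin
      (d ∸ m′ * m′) / c                  ≡⟨ cong (λ u → (u ∸ m′ * m′) / c) m′²+c*t≡d ⟨
      (m′ * m′ + c * t ∸ m′ * m′) / c    ≡⟨ cong (_/ c) (ℕP.m+n∸m≡n (m′ * m′) (c * t)) ⟩
      (c * t) / c                        ≡⟨ cong (_/ c) (ℕP.*-comm c t) ⟩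
      (t * c) / c                        ≡⟨ m*n/n≡m t c ⟩
      t                                  ∎
      where open ≡-Reasoning
    denominator = next-denominator m′≤r r<m′+c c≤r+m′ m′²+c*t≡d
    t≥1 : 1 ≤ t
    t≥1 = proj₁ denominator
    t≤r+m′ : t ≤ r + m′
    t≤r+m′ = proj₁ (proj₂ denominator)
    r<m′+t : r < m′ + t
    r<m′+t = proj₂ (proj₂ denominator)

ℤ-recurrence : ∀ {x} y z w → x ≡ y * z + w → + x ≡ + y ℤ.* + z ℤ.+ + w
ℤ-recurrence y z w refl = trans (ℤP.pos-+ (y * z) w) (cong (ℤ._+ + w) (ℤP.pos-* y z))

ℤ-monus : ∀ {x y} → y ≤ x → + (x ∸ y) ≡ + x ℤ.- + y
ℤ-monus {x} {y} y≤x = trans (sym (ℤP.⊖-≥ y≤x)) (sym (ℤP.m-n≡m⊖n x y))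

ℤ-nonZero : ∀ {n} → 1 ≤ n → ℤ.NonZero (+ n)
ℤ-nonZero {suc n} _ = _

form : ℕ → ℕ → ℕ → ℤ → ℤ → ℤ
form c m c′ u v = + c ℤ.* u ℤ.* u ℤ.- + 2 ℤ.* + m ℤ.* u ℤ.* v ℤ.- + c′ ℤ.* v ℤ.* v

IsUnit : ℤ → Set
IsUnit s = s ≡ + 1 ⊎ s ≡ ℤ.- + 1

-- Completing the square: (c u − m v)² = c · form + (m² + c c′) v².
form-lower-bound : ∀ {d m c c′ u v w s} → IsUnit s → m * m + c * c′ ≡ d → form c m c′ (+ u) (+ v) ≡ s →
                   (+ w ≡ + (c * u) ℤ.- + (m * v) ⊎ + w ≡ + (m * v) ℤ.- + (c * u)) →
                   d * (v * v) ≤ w * w + c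
form-lower-bound {d} {m} {c} {c′} {u} {v} {w} {s} unit norm form≡s w≡±W = bound unit
  where
  open ≡-Reasoning
  W = + (c * u) ℤ.- + (m * v)
  W²≡ : W ℤ.* W ≡ + c ℤ.* form c m c′ (+ u) (+ v) ℤ.+ (+ m ℤ.* + m ℤ.+ + c ℤ.* + c′) ℤ.* (+ v ℤ.* + v)
  W²≡ = trans (cong₂ (λ x y → (x ℤ.- y) ℤ.* (x ℤ.- y)) (ℤP.pos-* c u) (ℤP.pos-* m v)) (square (+ c) (+ u) (+ m) (+ v) (+ c′))
    where
    square : ∀ c u m v c′ → (c ℤ.* u ℤ.- m ℤ.* v) ℤ.* (c ℤ.* u ℤ.- m ℤ.* v)
                          ≡ c ℤ.* (c ℤ.* u ℤ.* u ℤ.- + 2 ℤ.* m ℤ.* u ℤ.* v ℤ.- c′ ℤ.* v ℤ.* v)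
                            ℤ.+ (m ℤ.* m ℤ.+ c ℤ.* c′) ℤ.* (v ℤ.* v)
    square = ℤ-solve
  w²≡W² : + w ℤ.* + w ≡ W ℤ.* W
  w²≡W² = square-of-± w≡±W
    where
    neg-square : ∀ x y → (y ℤ.- x) ℤ.* (y ℤ.- x) ≡ (x ℤ.- y) ℤ.* (x ℤ.- y)
    neg-square = ℤ-solve
    square-of-± : (+ w ≡ W ⊎ + w ≡ + (m * v) ℤ.- + (c * u)) → + w ℤ.* + w ≡ W ℤ.* W
    square-of-± (inj₁ e) = cong (λ x → x ℤ.* x) e
    square-of-± (inj₂ e) = trans (cong (λ x → x ℤ.* x) e) (neg-square (+ (c * u)) (+ (m * v)))
  w²≡cs+dv² : + (w * w) ≡ + c ℤ.* s ℤ.+ + (d * (v * v))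
  w²≡cs+dv² = begin
    + (w * w)                  ≡⟨ ℤP.pos-* w w ⟩
    + w ℤ.* + w                ≡⟨ w²≡W² ⟩
    W ℤ.* W                    ≡⟨ W²≡ ⟩
    + c ℤ.* form c m c′ (+ u) (+ v) ℤ.+ (+ m ℤ.* + m ℤ.+ + c ℤ.* + c′) ℤ.* (+ v ℤ.* + v)
      ≡⟨ cong₂ (λ x y → + c ℤ.* x ℤ.+ y ℤ.* (+ v ℤ.* + v)) form≡s (ℤ-norm m c c′ norm) ⟩
    + c ℤ.* s ℤ.+ + d ℤ.* (+ v ℤ.* + v)
      ≡⟨ cong (λ x → + c ℤ.* s ℤ.+ x) (trans (cong (+ d ℤ.*_) (sym (ℤP.pos-* v v))) (sym (ℤP.pos-* d (v * v)))) ⟩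
    + c ℤ.* s ℤ.+ + (d * (v * v)) ∎
  bound : IsUnit s → d * (v * v) ≤ w * w + c
  bound (inj₁ refl) = ℕP.≤-trans (ℕP.m≤n+m (d * (v * v)) c)
    (ℕP.≤-trans (ℕP.≤-reflexive (sym w²≡c+dv²)) (ℕP.m≤m+n (w * w) c))
    where
    w²≡c+dv² : w * w ≡ c + d * (v * v)
    w²≡c+dv² = ℤP.+-injective (trans w²≡cs+dv² (trans (cong (ℤ._+ + (d * (v * v))) (ℤP.*-identityʳ (+ c)))
                 (sym (ℤP.pos-+ c (d * (v * v))))))
  bound (inj₂ refl) = ℕP.≤-reflexive (sym (ℤP.+-injective (begin
    + (w * w + c)              ≡⟨ ℤP.pos-+ (w * w) c ⟩
    + (w * w) ℤ.+ + c          ≡⟨ cong (ℤ._+ + c) w²≡cs+dv² ⟩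
    + c ℤ.* ℤ.- + 1 ℤ.+ + (d * (v * v)) ℤ.+ + c ≡⟨ cancel (+ c) (+ (d * (v * v))) ⟩
    + (d * (v * v))            ∎)))
    where
    cancel : ∀ c x → c ℤ.* ℤ.- + 1 ℤ.+ x ℤ.+ c ≡ x
    cancel = ℤ-solve

root-bound : ∀ {d x y c v w} → x * x + y * c ≡ d → 1 ≤ y → 1 ≤ v → d * (v * v) ≤ w * w + c → x * v ≤ w
root-bound {d} {x} {y} {c} {v} {w} norm y≥1 v≥1 lower = sq-cancel-≤ (x * v) w (ℕP.+-cancelʳ-≤ c _ _ (begin
  x * v * (x * v) + c                 ≤⟨ ℕP.+-monoʳ-≤ (x * v * (x * v)) c≤y*v²*c ⟩
  x * v * (x * v) + y * (v * v) * c   ≡⟨ expand x v y c ⟩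
  (x * x + y * c) * (v * v)           ≡⟨ cong (_* (v * v)) norm ⟩
  d * (v * v)                         ≤⟨ lower ⟩
  w * w + c                           ∎))
  where
  open ℕP.≤-Reasoning
  c≤y*v²*c : c ≤ y * (v * v) * c
  c≤y*v²*c = ℕP.≤-trans (ℕP.≤-reflexive (sym (ℕP.*-identityˡ c))) (ℕP.*-monoˡ-≤ c (ℕP.*-mono-≤ y≥1 (ℕP.*-mono-≤ v≥1 v≥1)))
  expand : ∀ x v y c → x * v * (x * v) + y * (v * v) * c ≡ (x * x + y * c) * (v * v)
  expand = ℕ-solve

-- Lagrange: a unit value of the form at a positive point forces u ≥ a v, so the
-- inverse step (u, v) ↦ (v, u − a v) stays in the positive quadrant.
quotient-bound : ∀ {d r m c c′ a m′ c″ u v s} → Reduced d r m c c′ → 1 ≤ c′ → Step d r m c a m′ c″ →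
                 IsUnit s → 1 ≤ u → 1 ≤ v → form c m c′ (+ u) (+ v) ≡ s → a * v ≤ u
quotient-bound {d} {r} {m} {c} {c′} {a} {m′} {c″} {u} {v} state c′≥1 next unit u≥1 v≥1 form≡s
  with m * v ℕP.≤? c * u
... | no  m*v≰c*u = ⊥-elim (ℕP.<⇒≱ w<m*v (root-bound {x = m} norm-swapped c′≥1 v≥1
        (form-lower-bound {m = m} {c} {c′} unit norm form≡s (inj₂ w≡m*v-c*u))))
  where
  open Reduced state
  c*u<m*v = ℕP.≰⇒> m*v≰c*u
  w = m * v ∸ c * u
  w+c*u≡m*v : w + c * u ≡ m * v
  w+c*u≡m*v = ℕP.m∸n+n≡m (ℕP.<⇒≤ c*u<m*v)
  w≡m*v-c*u : + w ≡ + (m * v) ℤ.- + (c * u)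
  w≡m*v-c*u = ℤ-monus (ℕP.<⇒≤ c*u<m*v)
  w<m*v : w < m * v
  w<m*v = ℕP.<-≤-trans (ℕP.m<m+n w (ℕP.*-mono-≤ c≥1 u≥1)) (ℕP.≤-reflexive w+c*u≡m*v)
  norm-swapped : m * m + c′ * c ≡ d
  norm-swapped = trans (cong (_+_ (m * m)) (ℕP.*-comm c′ c)) norm
... | yes m*v≤c*u = ℕP.*-cancelˡ-≤ c (begin
  c * (a * v)      ≡⟨ regroup c a v ⟩
  a * c * v        ≡⟨ cong (_* v) m′+m≡a*c ⟨
  (m′ + m) * v     ≡⟨ ℕP.*-distribʳ-+ v m′ m ⟩
  m′ * v + m * v   ≤⟨ ℕP.+-monoˡ-≤ (m * v) m′*v≤w ⟩
  w + m * v        ≡⟨ w+m*v≡c*u ⟩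
  c * u            ∎)
  where
  open ℕP.≤-Reasoning
  open Reduced state using (c≥1)
  open Step next using (m′+m≡a*c; reduced)
  open Reduced reduced using () renaming (norm to norm′; c≥1 to c″≥1)
  instance
    c≢0 : ℕ.NonZero c
    c≢0 = ℕ.>-nonZero c≥1
  w = c * u ∸ m * v
  w+m*v≡c*u : w + m * v ≡ c * u
  w+m*v≡c*u = ℕP.m∸n+n≡m m*v≤c*u
  w≡c*u-m*v : + w ≡ + (c * u) ℤ.- + (m * v)
  w≡c*u-m*v = ℤ-monus m*v≤c*u
  m′*v≤w : m′ * v ≤ w
  m′*v≤w = root-bound {x = m′} norm′ c″≥1 v≥1 (form-lower-bound {m = m} {c} {c′} unit (Reduced.norm state) form≡s (inj₁ w≡c*u-m*v))
  regroup : ∀ c a v → c * (a * v) ≡ a * c * v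
  regroup = ℕ-solve

-- Periods

Period : (ℕ → ℕ) → ℕ → Set
Period f L = (k : ℕ) → 1 ≤ k → f (k + L) ≡ f k

module _ {f : ℕ → ℕ} where
  open ≡-Reasoning

  period-iterate : ∀ {L} → Period f L → ∀ t k → 1 ≤ k → f (k + t * L) ≡ f k
  period-iterate {L} per zero    k k≥1 = cong f (ℕP.+-identityʳ k)
  period-iterate {L} per (suc t) k k≥1 = begin
    f (k + (L + t * L))   ≡⟨ cong f (swap k L (t * L)) ⟩
    f (k + t * L + L)     ≡⟨ per (k + t * L) (ℕP.≤-trans k≥1 (ℕP.m≤m+n k (t * L))) ⟩
    f (k + t * L)         ≡⟨ period-iterate per t k k≥1 ⟩
    f k                   ∎
    where
    swap : ∀ k p q → k + (p + q) ≡ k + q + p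
    swap = ℕ-solve

  period-∸ : ∀ {K L} → Period f K → Period f L → L ≤ K → Period f (K ∸ L)
  period-∸ {K} {L} perK perL L≤K k k≥1 = begin
    f (k + (K ∸ L))       ≡⟨ perL (k + (K ∸ L)) (ℕP.≤-trans k≥1 (ℕP.m≤m+n k _)) ⟨
    f (k + (K ∸ L) + L)   ≡⟨ cong f (trans (ℕP.+-assoc k (K ∸ L) L) (cong (_+_ k) (ℕP.m∸n+n≡m L≤K))) ⟩
    f (k + K)             ≡⟨ perK k k≥1 ⟩
    f k                   ∎

  period-∸-multiple : ∀ {K L} → Period f K → Period f L → ∀ t → t * L ≤ K → Period f (K ∸ t * L)
  period-∸-multiple perK perL zero    _    = perK
  period-∸-multiple {K} {L} perK perL (suc t) L+tL≤K =
    subst (Period f) (trans (ℕP.∸-+-assoc K (t * L) L) (cong (K ∸_) (ℕP.+-comm (t * L) L)))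
      (period-∸ (period-∸-multiple perK perL t tL≤K) perL L≤K∸tL)
    where
    tL≤K = ℕP.≤-trans (ℕP.m≤n+m (t * L) L) L+tL≤K
    L≤K∸tL : L ≤ K ∸ t * L
    L≤K∸tL = ℕP.+-cancelʳ-≤ (t * L) L (K ∸ t * L)
      (ℕP.≤-trans L+tL≤K (ℕP.≤-reflexive (sym (ℕP.m∸n+n≡m tL≤K))))

  minimal-period-divides : ∀ {L} → 1 ≤ L → Period f L → ((L′ : ℕ) → 1 ≤ L′ → Period f L′ → L ≤ L′) →
                           ∀ {K} → Period f K → L ∣ K
  minimal-period-divides {suc L₀} _ perL minimal {K} perK = divides-if-remainder ρ refl
    where
    L = suc L₀
    ρ = K % L
    K≡ρ+[K/L]*L : K ≡ ρ + K / L * L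
    K≡ρ+[K/L]*L = m≡m%n+[m/n]*n K L
    perρ : Period f ρ
    perρ = subst (Period f) (trans (cong (_∸ K / L * L) K≡ρ+[K/L]*L) (ℕP.m+n∸n≡m ρ (K / L * L)))
             (period-∸-multiple perK perL (K / L) (ℕP.≤-trans (ℕP.m≤n+m (K / L * L) ρ) (ℕP.≤-reflexive (sym K≡ρ+[K/L]*L))))
    divides-if-remainder : ∀ x → x ≡ ρ → L ∣ K
    divides-if-remainder zero    x≡ρ = divides (K / L) (trans K≡ρ+[K/L]*L (cong (_+ K / L * L) (sym x≡ρ)))
    divides-if-remainder (suc x) x≡ρ = ⊥-elim (ℕP.<⇒≱ (m%n<n K L) (minimal ρ (subst (1 ≤_) x≡ρ (s≤s z≤n)) perρ))

-- Convergents of √d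

sign : ℕ → ℤ
sign zero    = + 1
sign (suc k) = ℤ.- sign k

sign-unit : ∀ k → IsUnit (sign k)
sign-unit zero    = inj₁ refl
sign-unit (suc k) with sign-unit k
... | inj₁ e = inj₂ (cong ℤ.-_ e)
... | inj₂ e = inj₁ (trans (cong ℤ.-_ e) (ℤP.neg-involutive (+ 1)))

sign-even : ∀ {k} → 2 ∣ k → sign k ≡ + 1
sign-even (divides t refl) = sign-double t
  where
  sign-double : ∀ t → sign (t * 2) ≡ + 1
  sign-double zero    = refl
  sign-double (suc t) = trans (ℤP.neg-involutive (sign (t * 2))) (sign-double t)

sign≡1⇒even : ∀ k → sign k ≡ + 1 → 2 ∣ k
sign≡1⇒even zero          _    = divides 0 refl
sign≡1⇒even (suc zero)    ()
sign≡1⇒even (suc (suc k)) even with sign≡1⇒even k (trans (sym (ℤP.neg-involutive (sign k))) even)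
... | divides t refl = divides (suc t) refl

suc[n∸1]≡n : ∀ {n} → 1 ≤ n → suc (n ∸ 1) ≡ n
suc[n∸1]≡n (s≤s z≤n) = refl

module ContinuedFractionOfSqrt (d : ℕ) (r²<d : isqrt d * isqrt d < d) where
  open ≡-Reasoning

  r = isqrt d

  r≥1 : 1 ≤ r
  r≥1 = isqrtAux-greatest d d 1 (ℕP.≤-trans (s≤s z≤n) d≥1) d≥1
    where
    d≥1 : 1 ≤ d
    d≥1 = ℕP.≤-trans (s≤s z≤n) r²<d

  m c c₋ a : ℕ → ℕ
  m k = proj₁ (cstate d k)
  c k = proj₂ (cstate d k)
  c₋ zero    = d
  c₋ (suc k) = c k
  a = cf d

  reduced : ∀ k → Reduced d r (m k) (c k) (c₋ k)
  step-at : ∀ k → Step d r (m k) (c k) (a k) (m (suc k)) (c (suc k))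
  step-at k = step r²<d (<[1+isqrt]² d) (reduced k)
  reduced zero    = record { c≥1 = s≤s z≤n ; m≤r = z≤n ; norm = ℕP.+-identityʳ d
                           ; c≤r+m = ℕP.≤-trans r≥1 (ℕP.≤-reflexive (sym (ℕP.+-identityʳ r))) }
  reduced (suc k) = Step.reduced (step-at k)

  c₋≥1 : ∀ k → 1 ≤ c₋ k
  c₋≥1 zero    = ℕP.≤-trans (s≤s z≤n) r²<d
  c₋≥1 (suc k) = Reduced.c≥1 (reduced k)

  a≥1 : ∀ k → 1 ≤ a k
  a≥1 k = Step.a≥1 (step-at k)

  -- Index shift: p k = p_{k−1} and p′ k = p_{k−2}, so that
  -- √d = (p k ξ_k + p′ k)/(q k ξ_k + q′ k) for the complete quotient ξ_k = (m k + √d)/c k.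
  p p′ q q′ : ℕ → ℕ
  p zero                = 1
  p (suc zero)          = a 0
  p (suc (suc k))       = a (suc k) * p (suc k) + p k
  p′ zero               = 0
  p′ (suc k)            = p k
  q zero                = 0
  q (suc zero)          = 1
  q (suc (suc k))       = a (suc k) * q (suc k) + q k
  q′ zero               = 1
  q′ (suc k)            = q k

  p-suc : ∀ k → p (suc k) ≡ a k * p k + p′ k
  p-suc zero    = sym (trans (ℕP.+-identityʳ _) (ℕP.*-identityʳ _))
  p-suc (suc k) = refl

  q-suc : ∀ k → q (suc k) ≡ a k * q k + q′ k
  q-suc zero    = sym (cong (_+ 1) (ℕP.*-zeroʳ (a 0)))
  q-suc (suc k) = refl

  convP≡p : ∀ j → convP d j ≡ p (suc j)
  convP≡p zero          = refl
  convP≡p (suc zero)    = refl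
  convP≡p (suc (suc j)) = cong₂ (λ x y → a (suc (suc j)) * x + y) (convP≡p (suc j)) (convP≡p j)

  convQ≡q : ∀ j → convQ d j ≡ q (suc j)
  convQ≡q zero          = refl
  convQ≡q (suc zero)    = sym (trans (ℕP.+-identityʳ _) (ℕP.*-identityʳ _))
  convQ≡q (suc (suc j)) = cong₂ (λ x y → a (suc (suc j)) * x + y) (convQ≡q (suc j)) (convQ≡q j)

  m-suc-ℤ : ∀ k → + m (suc k) ≡ + a k ℤ.* + c k ℤ.- + m k
  m-suc-ℤ k = trans (ℤ-monus m≤a*c) (cong (ℤ._- + m k) (ℤP.pos-* (a k) (c k)))
    where
    m≤a*c = ℕP.≤-trans (ℕP.m≤n+m (m k) (m (suc k))) (ℕP.≤-reflexive (Step.m′+m≡a*c (step-at k)))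

  c-suc-ℤ : ∀ k → + c (suc k) ≡ + c₋ k ℤ.+ + 2 ℤ.* + a k ℤ.* + m k ℤ.- + a k ℤ.* + a k ℤ.* + c k
  c-suc-ℤ k = ℤP.*-cancelˡ-≡ (+ c k) (+ c (suc k)) _ {{ℤ-nonZero (Reduced.c≥1 (reduced k))}} (begin
    + c k ℤ.* + c (suc k)
      ≡⟨ isolate (+ c k) (+ c (suc k)) (+ m (suc k)) ⟩
    (+ m (suc k) ℤ.* + m (suc k) ℤ.+ + c (suc k) ℤ.* + c k) ℤ.- + m (suc k) ℤ.* + m (suc k)
      ≡⟨ cong (ℤ._- + m (suc k) ℤ.* + m (suc k))
           (trans (ℤ-norm (m (suc k)) (c (suc k)) (c k) (Reduced.norm (reduced (suc k))))
                  (sym (ℤ-norm (m k) (c k) (c₋ k) (Reduced.norm (reduced k))))) ⟩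
    (+ m k ℤ.* + m k ℤ.+ + c k ℤ.* + c₋ k) ℤ.- + m (suc k) ℤ.* + m (suc k)
      ≡⟨ cong (λ x → (+ m k ℤ.* + m k ℤ.+ + c k ℤ.* + c₋ k) ℤ.- x ℤ.* x) (m-suc-ℤ k) ⟩
    (+ m k ℤ.* + m k ℤ.+ + c k ℤ.* + c₋ k) ℤ.- (+ a k ℤ.* + c k ℤ.- + m k) ℤ.* (+ a k ℤ.* + c k ℤ.- + m k)
      ≡⟨ expand (+ m k) (+ c k) (+ c₋ k) (+ a k) ⟩
    + c k ℤ.* (+ c₋ k ℤ.+ + 2 ℤ.* + a k ℤ.* + m k ℤ.- + a k ℤ.* + a k ℤ.* + c k) ∎)
    where
    isolate : ∀ c c″ m′ → c ℤ.* c″ ≡ (m′ ℤ.* m′ ℤ.+ c″ ℤ.* c) ℤ.- m′ ℤ.* m′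
    isolate = ℤ-solve
    expand : ∀ m c c₋ a → (m ℤ.* m ℤ.+ c ℤ.* c₋) ℤ.- (a ℤ.* c ℤ.- m) ℤ.* (a ℤ.* c ℤ.- m)
                        ≡ c ℤ.* (c₋ ℤ.+ + 2 ℤ.* a ℤ.* m ℤ.- a ℤ.* a ℤ.* c)
    expand = ℤ-solve

  F : ℕ → ℤ → ℤ → ℤ
  F k = form (c k) (m k) (c₋ k)

  F-step : ∀ k u v → F (suc k) v (u ℤ.- + a k ℤ.* v) ≡ ℤ.- F k u v
  F-step k u v = trans
    (cong₂ (λ m′ c″ → c″ ℤ.* v ℤ.* v ℤ.- + 2 ℤ.* m′ ℤ.* v ℤ.* (u ℤ.- + a k ℤ.* v)
                      ℤ.- + c k ℤ.* (u ℤ.- + a k ℤ.* v) ℤ.* (u ℤ.- + a k ℤ.* v))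
           (m-suc-ℤ k) (c-suc-ℤ k))
    (reduce (+ a k) (+ c k) (+ m k) (+ c₋ k) u v)
    where
    reduce : ∀ a c m c₋ u v
      → (c₋ ℤ.+ + 2 ℤ.* a ℤ.* m ℤ.- a ℤ.* a ℤ.* c) ℤ.* v ℤ.* v ℤ.- + 2 ℤ.* (a ℤ.* c ℤ.- m) ℤ.* v ℤ.* (u ℤ.- a ℤ.* v)
        ℤ.- c ℤ.* (u ℤ.- a ℤ.* v) ℤ.* (u ℤ.- a ℤ.* v)
      ≡ ℤ.- (c ℤ.* u ℤ.* u ℤ.- + 2 ℤ.* m ℤ.* u ℤ.* v ℤ.- c₋ ℤ.* v ℤ.* v)
    reduce = ℤ-solve

  F-axis : ∀ k u → F k (+ u) (+ 0) ≡ + (c k * u * u)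
  F-axis k u = trans (vanish (+ c k) (+ m k) (+ c₋ k) (+ u))
    (trans (cong (ℤ._* + u) (sym (ℤP.pos-* (c k) u))) (sym (ℤP.pos-* (c k * u) u)))
    where
    vanish : ∀ c m c₋ u → c ℤ.* u ℤ.* u ℤ.- + 2 ℤ.* m ℤ.* u ℤ.* + 0 ℤ.- c₋ ℤ.* + 0 ℤ.* + 0 ≡ c ℤ.* u ℤ.* u
    vanish = ℤ-solve

  recurrence-step : ∀ {x x′ x₊ a} u″ v → x₊ ≡ a * x + x′ → x * (u″ + a * v) + x′ * v ≡ x₊ * v + x * u″
  recurrence-step {x} {x′} {a = a} u″ v refl = regroup x x′ a u″ v
    where
    regroup : ∀ x x′ a u″ v → x * (u″ + a * v) + x′ * v ≡ (a * x + x′) * v + x * u″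
    regroup = ℕ-solve

  record ReachesUnit (k u v : ℕ) : Set where
    field
      j    : ℕ
      c≡1  : c j ≡ 1
      even : sign j ≡ + 1
      p-eq : p k * u + p′ k * v ≡ p j
      q-eq : q k * u + q′ k * v ≡ q j

  -- Descent through the inverse steps (u, v) ↦ (v, u − a_k v), on which F changes sign;
  -- it stops on the axis v = 0, where F = c u² = 1.
  descent : ∀ n k u v → u + v ≤ n → 1 ≤ u → F k (+ u) (+ v) ≡ sign k → ReachesUnit k u v
  descent n k u zero _ _ F≡sign with sign-unit k
  ... | inj₂ sign≡-1 with trans (sym (F-axis k u)) (trans F≡sign sign≡-1)
  ...   | ()
  descent n k u zero _ _ F≡sign | inj₁ sign≡1 = record
    { j = k ; c≡1 = ℕP.m*n≡1⇒m≡1 (c k) u cu≡1 ; even = sign≡1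
    ; p-eq = axis-value (p k) (p′ k) ; q-eq = axis-value (q k) (q′ k) }
    where
    cu≡1 : c k * u ≡ 1
    cu≡1 = ℕP.m*n≡1⇒m≡1 (c k * u) u (ℤP.+-injective (trans (sym (F-axis k u)) (trans F≡sign sign≡1)))
    axis-value : ∀ x x′ → x * u + x′ * 0 ≡ x
    axis-value x x′ rewrite ℕP.m*n≡1⇒n≡1 (c k) u cu≡1 | ℕP.*-zeroʳ x′ = trans (ℕP.+-identityʳ _) (ℕP.*-identityʳ x)
  descent zero    k u (suc v₀) u+v≤0 _ _ = ⊥-elim (ℕP.<⇒≱ (ℕP.≤-trans (s≤s z≤n) (ℕP.m≤n+m (suc v₀) u)) u+v≤0)
  descent (suc n) k u (suc v₀) u+v≤n u≥1 F≡sign = record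
    { j = j ; c≡1 = c≡1 ; even = even
    ; p-eq = lift (p-suc k) p-eq ; q-eq = lift (q-suc k) q-eq }
    where
    v = suc v₀
    av≤u : a k * v ≤ u
    av≤u = quotient-bound (reduced k) (c₋≥1 k) (step-at k) (sign-unit k) u≥1 (s≤s z≤n) F≡sign
    u″ = u ∸ a k * v
    u″+av≡u : u″ + a k * v ≡ u
    u″+av≡u = ℕP.m∸n+n≡m av≤u
    u″<u : u″ < u
    u″<u = ℕP.<-≤-trans (ℕP.m<m+n u″ (ℕP.*-mono-≤ (a≥1 k) (s≤s z≤n))) (ℕP.≤-reflexive u″+av≡u)
    v+u″≤n : v + u″ ≤ n
    v+u″≤n = ℕP.≤-pred (ℕP.≤-trans (ℕP.≤-trans (ℕP.≤-reflexive (cong suc (ℕP.+-comm v u″))) (ℕP.+-monoˡ-< v u″<u)) u+v≤n)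
    u″≡u-av : + u″ ≡ + u ℤ.- + a k ℤ.* + v
    u″≡u-av = trans (ℤ-monus av≤u) (cong (λ t → + u ℤ.- t) (ℤP.pos-* (a k) v))
    F′≡sign : F (suc k) (+ v) (+ u″) ≡ sign (suc k)
    F′≡sign = trans (cong (F (suc k) (+ v)) u″≡u-av) (trans (F-step k (+ u) (+ v)) (cong ℤ.-_ F≡sign))
    open ReachesUnit (descent n (suc k) v u″ v+u″≤n (s≤s z≤n) F′≡sign)
    lift : ∀ {x x′ x₊ y} → x₊ ≡ a k * x + x′ → x₊ * v + x * u″ ≡ y → x * u + x′ * v ≡ y
    lift {x} {x′} rec e = trans (cong (λ t → x * t + x′ * v) (sym u″+av≡u)) (trans (recurrence-step {x} {x′} {a = a k} u″ v rec) e)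

  pell-value : ℤ → ℤ → ℤ → ℤ → ℤ → ℤ → ℤ
  pell-value x x′ y y′ u v = (x ℤ.* u ℤ.+ x′ ℤ.* v) ℤ.* (x ℤ.* u ℤ.+ x′ ℤ.* v)
                             ℤ.- + d ℤ.* ((y ℤ.* u ℤ.+ y′ ℤ.* v) ℤ.* (y ℤ.* u ℤ.+ y′ ℤ.* v))

  pell-value≡F : ∀ k u v → pell-value (+ p k) (+ p′ k) (+ q k) (+ q′ k) u v ≡ sign k ℤ.* F k u v
  pell-value≡F zero    u v = initial (+ d) u v
    where
    initial : ∀ D u v → (+ 1 ℤ.* u ℤ.+ + 0 ℤ.* v) ℤ.* (+ 1 ℤ.* u ℤ.+ + 0 ℤ.* v)
                          ℤ.- D ℤ.* ((+ 0 ℤ.* u ℤ.+ + 1 ℤ.* v) ℤ.* (+ 0 ℤ.* u ℤ.+ + 1 ℤ.* v))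
                      ≡ + 1 ℤ.* (+ 1 ℤ.* u ℤ.* u ℤ.- + 2 ℤ.* + 0 ℤ.* u ℤ.* v ℤ.- D ℤ.* v ℤ.* v)
    initial = ℤ-solve
  pell-value≡F (suc k) u v = begin
    pell-value (+ p (suc k)) (+ p k) (+ q (suc k)) (+ q k) u v
      ≡⟨ cong₂ (λ x y → pell-value x (+ p k) y (+ q k) u v)
           (ℤ-recurrence (a k) (p k) (p′ k) (p-suc k)) (ℤ-recurrence (a k) (q k) (q′ k) (q-suc k)) ⟩
    pell-value (A ℤ.* P ℤ.+ P′) P (A ℤ.* Q ℤ.+ Q′) Q u v
      ≡⟨ substitute A P P′ Q Q′ u v (+ d) ⟩
    pell-value P P′ Q Q′ U u
      ≡⟨ pell-value≡F k U u ⟩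
    sign k ℤ.* F k U u
      ≡⟨ cong (sign k ℤ.*_) (ℤP.neg-involutive (F k U u)) ⟨
    sign k ℤ.* ℤ.- (ℤ.- F k U u)
      ≡⟨ cong (λ t → sign k ℤ.* ℤ.- t) (F-step k U u) ⟨
    sign k ℤ.* ℤ.- F (suc k) u (U ℤ.- A ℤ.* u)
      ≡⟨ cong (λ t → sign k ℤ.* ℤ.- F (suc k) u t) (cancel A u v) ⟩
    sign k ℤ.* ℤ.- F (suc k) u v
      ≡⟨ ℤP.neg-distribʳ-* (sign k) (F (suc k) u v) ⟨
    ℤ.- (sign k ℤ.* F (suc k) u v)
      ≡⟨ ℤP.neg-distribˡ-* (sign k) (F (suc k) u v) ⟩
    sign (suc k) ℤ.* F (suc k) u v ∎
    where
    A = + a k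
    P = + p k
    P′ = + p′ k
    Q = + q k
    Q′ = + q′ k
    U = A ℤ.* u ℤ.+ v
    substitute : ∀ A P P′ Q Q′ u v D →
      ((A ℤ.* P ℤ.+ P′) ℤ.* u ℤ.+ P ℤ.* v) ℤ.* ((A ℤ.* P ℤ.+ P′) ℤ.* u ℤ.+ P ℤ.* v)
        ℤ.- D ℤ.* (((A ℤ.* Q ℤ.+ Q′) ℤ.* u ℤ.+ Q ℤ.* v) ℤ.* ((A ℤ.* Q ℤ.+ Q′) ℤ.* u ℤ.+ Q ℤ.* v))
      ≡ (P ℤ.* (A ℤ.* u ℤ.+ v) ℤ.+ P′ ℤ.* u) ℤ.* (P ℤ.* (A ℤ.* u ℤ.+ v) ℤ.+ P′ ℤ.* u)
        ℤ.- D ℤ.* ((Q ℤ.* (A ℤ.* u ℤ.+ v) ℤ.+ Q′ ℤ.* u) ℤ.* (Q ℤ.* (A ℤ.* u ℤ.+ v) ℤ.+ Q′ ℤ.* u))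
    substitute = ℤ-solve
    cancel : ∀ A u v → A ℤ.* u ℤ.+ v ℤ.- A ℤ.* u ≡ v
    cancel = ℤ-solve

  pell-at-unit : ∀ k → c k ≡ 1 → sign k ≡ + 1 → p k * p k ≡ d * (q k * q k) + 1
  pell-at-unit k c≡1 even = ℤP.+-injective (begin
    + (p k * p k)                               ≡⟨ ℤP.pos-* (p k) (p k) ⟩
    P ℤ.* P                                     ≡⟨ split P Q (+ p′ k) (+ q′ k) (+ d) ⟩
    pell-value P (+ p′ k) Q (+ q′ k) (+ 1) (+ 0) ℤ.+ + d ℤ.* (Q ℤ.* Q)
      ≡⟨ cong (ℤ._+ + d ℤ.* (Q ℤ.* Q)) (pell-value≡F k (+ 1) (+ 0)) ⟩
    sign k ℤ.* F k (+ 1) (+ 0) ℤ.+ + d ℤ.* (Q ℤ.* Q)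
      ≡⟨ cong₂ (λ s f → s ℤ.* f ℤ.+ + d ℤ.* (Q ℤ.* Q)) even (trans (F-axis k 1) (cong (λ x → + (x * 1 * 1)) c≡1)) ⟩
    + 1 ℤ.* + 1 ℤ.+ + d ℤ.* (Q ℤ.* Q)           ≡⟨ ℤP.+-comm (+ 1) (+ d ℤ.* (Q ℤ.* Q)) ⟩
    + d ℤ.* (Q ℤ.* Q) ℤ.+ + 1                   ≡⟨ cong (λ x → + d ℤ.* x ℤ.+ + 1) (ℤP.pos-* (q k) (q k)) ⟨
    + d ℤ.* + (q k * q k) ℤ.+ + 1               ≡⟨ cong (ℤ._+ + 1) (ℤP.pos-* d (q k * q k)) ⟨
    + (d * (q k * q k)) ℤ.+ + 1                 ≡⟨ ℤP.pos-+ (d * (q k * q k)) 1 ⟨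
    + (d * (q k * q k) + 1)                     ∎)
    where
    P = + p k
    Q = + q k
    split : ∀ P Q P′ Q′ D → P ℤ.* P ≡ ((P ℤ.* + 1 ℤ.+ P′ ℤ.* + 0) ℤ.* (P ℤ.* + 1 ℤ.+ P′ ℤ.* + 0)
                                      ℤ.- D ℤ.* ((Q ℤ.* + 1 ℤ.+ Q′ ℤ.* + 0) ℤ.* (Q ℤ.* + 1 ℤ.+ Q′ ℤ.* + 0)))
                                      ℤ.+ D ℤ.* (Q ℤ.* Q)
    split = ℤ-solve

  convergent-identities : ∀ k → (p k ≡ m k * q k + c k * q′ k) × (d * q k ≡ m k * p k + c k * p′ k)
  convergent-identities zero    = refl , ℕP.*-zeroʳ d
  convergent-identities (suc k) = p-identity , q-identity
    where
    mₖ = m k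
    cₖ = c k
    aₖ = a k
    m₊ = m (suc k)
    c₊ = c (suc k)
    p-IH = proj₁ (convergent-identities k)
    q-IH = proj₂ (convergent-identities k)
    m′+m≡a*c : m₊ + mₖ ≡ aₖ * cₖ
    m′+m≡a*c = Step.m′+m≡a*c (step-at k)
    norm′ : m₊ * m₊ + c₊ * cₖ ≡ d
    norm′ = Reduced.norm (reduced (suc k))
    instance
      cₖ≢0 : ℕ.NonZero cₖ
      cₖ≢0 = ℕ.>-nonZero (Reduced.c≥1 (reduced k))
    c*p₊ : cₖ * p (suc k) ≡ m₊ * p k + d * q k
    c*p₊ = ℕP.+-cancelʳ-≡ (mₖ * p k) _ _ (begin
      cₖ * p (suc k) + mₖ * p k            ≡⟨ cong (λ t → cₖ * t + mₖ * p k) (p-suc k) ⟩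
      cₖ * (aₖ * p k + p′ k) + mₖ * p k     ≡⟨ regroup cₖ aₖ (p k) (p′ k) mₖ ⟩
      aₖ * cₖ * p k + (mₖ * p k + cₖ * p′ k) ≡⟨ cong₂ (λ x y → x * p k + y) m′+m≡a*c q-IH ⟨
      (m₊ + mₖ) * p k + d * q k           ≡⟨ spread m₊ mₖ (p k) (d * q k) ⟩
      m₊ * p k + d * q k + mₖ * p k       ∎)
      where
      regroup : ∀ cₖ aₖ x x′ mₖ → cₖ * (aₖ * x + x′) + mₖ * x ≡ aₖ * cₖ * x + (mₖ * x + cₖ * x′)
      regroup = ℕ-solve
      spread : ∀ m₊ mₖ x y → (m₊ + mₖ) * x + y ≡ m₊ * x + y + mₖ * x
      spread = ℕ-solve
    c*d*q₊ : cₖ * (d * q (suc k)) ≡ m₊ * (d * q k) + d * p k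
    c*d*q₊ = ℕP.+-cancelʳ-≡ (d * (mₖ * q k)) _ _ (begin
      cₖ * (d * q (suc k)) + d * (mₖ * q k)            ≡⟨ cong (λ t → cₖ * (d * t) + d * (mₖ * q k)) (q-suc k) ⟩
      cₖ * (d * (aₖ * q k + q′ k)) + d * (mₖ * q k)     ≡⟨ regroup cₖ d aₖ (q k) (q′ k) mₖ ⟩
      d * q k * (aₖ * cₖ) + d * (mₖ * q k + cₖ * q′ k)   ≡⟨ cong₂ (λ x y → d * q k * x + d * y) m′+m≡a*c p-IH ⟨
      d * q k * (m₊ + mₖ) + d * p k                   ≡⟨ spread d (q k) m₊ mₖ (p k) ⟩
      m₊ * (d * q k) + d * p k + d * (mₖ * q k)       ∎)
      where
      regroup : ∀ cₖ d aₖ y y′ mₖ → cₖ * (d * (aₖ * y + y′)) + d * (mₖ * y) ≡ d * y * (aₖ * cₖ) + d * (mₖ * y + cₖ * y′)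
      regroup = ℕ-solve
      spread : ∀ d y m₊ mₖ x → d * y * (m₊ + mₖ) + d * x ≡ m₊ * (d * y) + d * x + d * (mₖ * y)
      spread = ℕ-solve
    -- shared by both identities, with (x, y) = (q, p) and (p, d q)
    c*next : ∀ {x x′ x₊ y} → x₊ ≡ aₖ * x + x′ → y ≡ mₖ * x + cₖ * x′ →
             cₖ * (m₊ * x₊ + c₊ * x) ≡ m₊ * y + d * x
    c*next {x} {x′} {y = y} refl y≡ = begin
      cₖ * (m₊ * (aₖ * x + x′) + c₊ * x)          ≡⟨ regroup cₖ m₊ aₖ x x′ c₊ ⟩
      m₊ * x * (aₖ * cₖ) + m₊ * (cₖ * x′) + c₊ * cₖ * x ≡⟨ cong (λ t → m₊ * x * t + m₊ * (cₖ * x′) + c₊ * cₖ * x) m′+m≡a*c ⟨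
      m₊ * x * (m₊ + mₖ) + m₊ * (cₖ * x′) + c₊ * cₖ * x ≡⟨ collect m₊ x mₖ cₖ x′ c₊ ⟩
      m₊ * (mₖ * x + cₖ * x′) + (m₊ * m₊ + c₊ * cₖ) * x ≡⟨ cong₂ (λ s t → m₊ * s + t * x) (sym y≡) norm′ ⟩
      m₊ * y + d * x                                  ∎
      where
      regroup : ∀ cₖ m₊ aₖ x x′ c₊ → cₖ * (m₊ * (aₖ * x + x′) + c₊ * x)
                                    ≡ m₊ * x * (aₖ * cₖ) + m₊ * (cₖ * x′) + c₊ * cₖ * x
      regroup = ℕ-solve
      collect : ∀ m₊ x mₖ cₖ x′ c₊ → m₊ * x * (m₊ + mₖ) + m₊ * (cₖ * x′) + c₊ * cₖ * x
                                   ≡ m₊ * (mₖ * x + cₖ * x′) + (m₊ * m₊ + c₊ * cₖ) * x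
      collect = ℕ-solve
    p-identity : p (suc k) ≡ m₊ * q (suc k) + c₊ * q k
    p-identity = ℕP.*-cancelˡ-≡ _ _ cₖ (trans c*p₊ (sym (c*next {q k} {q′ k} (q-suc k) p-IH)))
    q-identity : d * q (suc k) ≡ m₊ * p (suc k) + c₊ * p k
    q-identity = ℕP.*-cancelˡ-≡ _ _ cₖ (trans c*d*q₊ (sym (c*next {p k} {p′ k} (p-suc k) q-IH)))


  m≡r-at-unit : ∀ k → c (suc k) ≡ 1 → m (suc k) ≡ r
  m≡r-at-unit k c≡1 = ℕP.≤-antisym (Reduced.m≤r (reduced (suc k)))
    (ℕP.≤-pred (ℕP.≤-trans (Step.r<m′+c″ (step-at k))
      (ℕP.≤-reflexive (trans (cong (_+_ (m (suc k))) c≡1) (ℕP.+-comm (m (suc k)) 1)))))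

  a≡2r-at-unit : ∀ k → c (suc k) ≡ 1 → a (suc k) ≡ r + r
  a≡2r-at-unit k c≡1 = trans (cong₂ (pquot d) (m≡r-at-unit k c≡1) c≡1) (n/1≡n (r + r))

  step-from-r≡step-from-0 : cstep d (r , 1) ≡ cstep d (0 , 1)
  step-from-r≡step-from-0 = cong (λ x → x , (d ∸ x * x) div 1) (begin
    (r + r) / 1 * 1 ∸ r    ≡⟨ cong (λ x → x * 1 ∸ r) (n/1≡n (r + r)) ⟩
    (r + r) * 1 ∸ r        ≡⟨ cong (_∸ r) (ℕP.*-identityʳ (r + r)) ⟩
    r + r ∸ r              ≡⟨ ℕP.m+n∸n≡m r r ⟩
    r                      ≡⟨ ℕP.*-identityʳ r ⟨
    r * 1                  ≡⟨ cong (_* 1) (n/1≡n r) ⟨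
    r / 1 * 1              ∎)

  state-repeats : ∀ k → c (suc k) ≡ 1 → ∀ i → cstate d (suc i + suc k) ≡ cstate d (suc i)
  state-repeats k c≡1 zero    = trans (cong (cstep d) (cong₂ _,_ (m≡r-at-unit k c≡1) c≡1)) step-from-r≡step-from-0
  state-repeats k c≡1 (suc i) = cong (cstep d) (state-repeats k c≡1 i)

  period-at-unit : ∀ k → c (suc k) ≡ 1 → Period (cf d) (suc k)
  period-at-unit k c≡1 (suc i) _ = cong (λ s → pquot d (proj₁ s) (proj₂ s)) (state-repeats k c≡1 i)

  a₀≡r : a 0 ≡ r
  a₀≡r = n/1≡n r

  -- Shifting the index by a unit period P multiplies p + q√d by x + y√d = p P + q P √d.
  module UnitShift (P₀ : ℕ) (c≡1 : c (suc P₀) ≡ 1) where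
    P = suc P₀
    x = p P
    y = q P

    x≡ry+q′ : x ≡ r * y + q′ P
    x≡ry+q′ = begin
      x                      ≡⟨ proj₁ (convergent-identities P) ⟩
      m P * y + c P * q′ P   ≡⟨ cong₂ (λ u v → u * y + v * q′ P) (m≡r-at-unit P₀ c≡1) c≡1 ⟩
      r * y + 1 * q′ P       ≡⟨ cong (_+_ (r * y)) (ℕP.*-identityˡ (q′ P)) ⟩
      r * y + q′ P           ∎

    dy≡rx+p′ : d * y ≡ r * x + p′ P
    dy≡rx+p′ = begin
      d * y                  ≡⟨ proj₂ (convergent-identities P) ⟩
      m P * x + c P * p′ P   ≡⟨ cong₂ (λ u v → u * x + v * p′ P) (m≡r-at-unit P₀ c≡1) c≡1 ⟩
      r * x + 1 * p′ P       ≡⟨ cong (_+_ (r * x)) (ℕP.*-identityˡ (p′ P)) ⟩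
      r * x + p′ P           ∎

    Shifted : ℕ → Set
    Shifted k = (p (k + P) ≡ x * p k + d * (y * q k)) × (q (k + P) ≡ y * p k + x * q k)

    shifted : ∀ k → Shifted k × Shifted (suc k)
    shifted zero = (p-shift₀ , q-shift₀) , (p-shift₁ , q-shift₁)
      where
      p-shift₀ : x ≡ x * 1 + d * (y * 0)
      p-shift₀ = sym (trans (cong₂ _+_ (ℕP.*-identityʳ x) (trans (cong (d *_) (ℕP.*-zeroʳ y)) (ℕP.*-zeroʳ d))) (ℕP.+-identityʳ x))
      q-shift₀ : y ≡ y * 1 + x * 0
      q-shift₀ = sym (trans (cong₂ _+_ (ℕP.*-identityʳ y) (ℕP.*-zeroʳ x)) (ℕP.+-identityʳ y))
      p-shift₁ : p (suc P) ≡ x * p 1 + d * (y * q 1)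
      p-shift₁ = begin
        a P * x + p′ P              ≡⟨ cong (λ t → t * x + p′ P) (a≡2r-at-unit P₀ c≡1) ⟩
        (r + r) * x + p′ P          ≡⟨ split r x (p′ P) ⟩
        r * x + (r * x + p′ P)      ≡⟨ cong (_+_ (r * x)) dy≡rx+p′ ⟨
        r * x + d * y               ≡⟨ arrange x r d y ⟩
        x * r + d * (y * 1)         ≡⟨ cong (λ t → x * t + d * (y * 1)) a₀≡r ⟨
        x * p 1 + d * (y * q 1)     ∎
        where
        split : ∀ r x z → (r + r) * x + z ≡ r * x + (r * x + z)
        split = ℕ-solve
        arrange : ∀ x r d y → r * x + d * y ≡ x * r + d * (y * 1)
        arrange = ℕ-solve
      q-shift₁ : q (suc P) ≡ y * p 1 + x * q 1
      q-shift₁ = begin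
        a P * y + q′ P              ≡⟨ cong (λ t → t * y + q′ P) (a≡2r-at-unit P₀ c≡1) ⟩
        (r + r) * y + q′ P          ≡⟨ split r y (q′ P) ⟩
        r * y + (r * y + q′ P)      ≡⟨ cong (_+_ (r * y)) x≡ry+q′ ⟨
        r * y + x                   ≡⟨ arrange x r y ⟩
        y * r + x * 1               ≡⟨ cong (λ t → y * t + x * 1) a₀≡r ⟨
        y * p 1 + x * q 1           ∎
        where
        split : ∀ r x z → (r + r) * x + z ≡ r * x + (r * x + z)
        split = ℕ-solve
        arrange : ∀ x r y → r * y + x ≡ y * r + x * 1
        arrange = ℕ-solve
    shifted (suc k) = proj₂ (shifted k) , (p-shift , q-shift)
      where
      IH₀ = proj₁ (shifted k)
      IH₁ = proj₂ (shifted k)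
      A = a (suc k)
      a-periodic : a (suc k + P) ≡ A
      a-periodic = period-at-unit P₀ c≡1 (suc k) (s≤s z≤n)
      p-shift : p (suc (suc k) + P) ≡ x * p (suc (suc k)) + d * (y * q (suc (suc k)))
      p-shift = begin
        a (suc k + P) * p (suc k + P) + p (k + P)
          ≡⟨ cong₂ (λ u v → u * v + p (k + P)) a-periodic (proj₁ IH₁) ⟩
        A * (x * p (suc k) + d * (y * q (suc k))) + p (k + P)
          ≡⟨ cong (_+_ (A * (x * p (suc k) + d * (y * q (suc k))))) (proj₁ IH₀) ⟩
        A * (x * p (suc k) + d * (y * q (suc k))) + (x * p k + d * (y * q k))
          ≡⟨ collect A x d y (p (suc k)) (q (suc k)) (p k) (q k) ⟩
        x * (A * p (suc k) + p k) + d * (y * (A * q (suc k) + q k)) ∎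
        where
        collect : ∀ A x d y P Q P′ Q′ → A * (x * P + d * (y * Q)) + (x * P′ + d * (y * Q′))
                                      ≡ x * (A * P + P′) + d * (y * (A * Q + Q′))
        collect = ℕ-solve
      q-shift : q (suc (suc k) + P) ≡ y * p (suc (suc k)) + x * q (suc (suc k))
      q-shift = begin
        a (suc k + P) * q (suc k + P) + q (k + P)
          ≡⟨ cong₂ (λ u v → u * v + q (k + P)) a-periodic (proj₂ IH₁) ⟩
        A * (y * p (suc k) + x * q (suc k)) + q (k + P)
          ≡⟨ cong (_+_ (A * (y * p (suc k) + x * q (suc k)))) (proj₂ IH₀) ⟩
        A * (y * p (suc k) + x * q (suc k)) + (y * p k + x * q k)
          ≡⟨ collect A x y (p (suc k)) (q (suc k)) (p k) (q k) ⟩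
        y * (A * p (suc k) + p k) + x * (A * q (suc k) + q k) ∎
        where
        collect : ∀ A x y P Q P′ Q′ → A * (y * P + x * Q) + (y * P′ + x * Q′)
                                    ≡ y * (A * P + P′) + x * (A * Q + Q′)
        collect = ℕ-solve

    convergents-at-multiples : ∀ t → (p (t * P) ≡ proj₁ (pellPower d x y t)) × (q (t * P) ≡ proj₂ (pellPower d x y t))
    convergents-at-multiples zero    = refl , refl
    convergents-at-multiples (suc t) =
      trans (cong p (ℕP.+-comm P (t * P))) (trans (proj₁ shift) (cong₂ (λ u v → x * u + d * (y * v)) (proj₁ IH) (proj₂ IH))) ,
      trans (cong q (ℕP.+-comm P (t * P))) (trans (proj₂ shift) (cong₂ (λ u v → y * u + x * v) (proj₁ IH) (proj₂ IH)))
      where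
      shift = proj₁ (shifted (t * P))
      IH = convergents-at-multiples t


  x≤a*x : ∀ k x → x ≤ a k * x
  x≤a*x k x = ℕP.m≤n*m x (a k) {{ℕ.>-nonZero (a≥1 k)}}

  q-pos : ∀ k → 1 ≤ q (suc k)
  q-pos zero    = s≤s z≤n
  q-pos (suc k) = ℕP.≤-trans (q-pos k) (ℕP.≤-trans (x≤a*x (suc k) (q (suc k))) (ℕP.m≤m+n _ (q k)))

  p-pos : ∀ k → 1 ≤ p k
  p-pos zero          = s≤s z≤n
  p-pos (suc zero)    = a≥1 0
  p-pos (suc (suc k)) = ℕP.≤-trans (p-pos k) (ℕP.m≤n+m (p k) _)

  q-step : ∀ {k} → 2 ≤ k → q k < q (suc k)
  q-step {suc zero}    (s≤s ())
  q-step {suc (suc k)} _ = ℕP.<-≤-trans (ℕP.m<m+n (q (suc (suc k))) (q-pos k))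
    (ℕP.+-monoˡ-≤ (q (suc k)) (x≤a*x (suc (suc k)) (q (suc (suc k)))))

  q-strictMono : ∀ {i j} → 2 ≤ i → i < j → q i < q j
  q-strictMono {i} {suc j} 2≤i i<1+j with ℕP.m≤n⇒m<n∨m≡n (ℕP.≤-pred i<1+j)
  ... | inj₁ i<j  = ℕP.<-trans (q-strictMono 2≤i i<j) (q-step (ℕP.≤-trans 2≤i (ℕP.<⇒≤ i<j)))
  ... | inj₂ refl = q-step 2≤i

-- The fundamental solution among the convergents

module FundamentalSolution
  (d : ℕ) (r²<d : isqrt d * isqrt d < d)
  (x₁ y₁ : ℕ) (x₁≥1 : 1 ≤ x₁) (y₁≥1 : 1 ≤ y₁) (pell : x₁ * x₁ ≡ d * (y₁ * y₁) + 1)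
  (least : (x y : ℕ) → 1 ≤ x → 1 ≤ y → x * x ≡ d * (y * y) + 1 → y₁ ≤ y)
  (L : ℕ) (L≥1 : 1 ≤ L) (period : Period (cf d) L)
  (minimal : (L′ : ℕ) → 1 ≤ L′ → Period (cf d) L′ → L ≤ L′)
  where
  open ContinuedFractionOfSqrt d r²<d

  F₀≡1 : F 0 (+ x₁) (+ y₁) ≡ + 1
  F₀≡1 = begin
    F 0 (+ x₁) (+ y₁)                              ≡⟨ unfold (+ x₁) (+ y₁) (+ d) ⟩
    + x₁ ℤ.* + x₁ ℤ.- + d ℤ.* (+ y₁ ℤ.* + y₁)
      ≡⟨ cong₂ ℤ._-_ (ℤP.pos-* x₁ x₁) (trans (ℤP.pos-* d (y₁ * y₁)) (cong (+ d ℤ.*_) (ℤP.pos-* y₁ y₁))) ⟨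
    + (x₁ * x₁) ℤ.- + (d * (y₁ * y₁))              ≡⟨ cong (λ u → + u ℤ.- + (d * (y₁ * y₁))) pell ⟩
    + (d * (y₁ * y₁) + 1) ℤ.- + (d * (y₁ * y₁))    ≡⟨ cong (ℤ._- + (d * (y₁ * y₁))) (ℤP.pos-+ (d * (y₁ * y₁)) 1) ⟩
    + (d * (y₁ * y₁)) ℤ.+ + 1 ℤ.- + (d * (y₁ * y₁)) ≡⟨ cancel (+ (d * (y₁ * y₁))) ⟩
    + 1                                            ∎
    where
    open ≡-Reasoning
    unfold : ∀ u v D → + 1 ℤ.* u ℤ.* u ℤ.- + 2 ℤ.* + 0 ℤ.* u ℤ.* v ℤ.- D ℤ.* v ℤ.* v ≡ u ℤ.* u ℤ.- D ℤ.* (v ℤ.* v)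
    unfold = ℤ-solve
    cancel : ∀ z → z ℤ.+ + 1 ℤ.- z ≡ + 1
    cancel = ℤ-solve

  reached : ReachesUnit 0 x₁ y₁
  reached = descent (x₁ + y₁) 0 x₁ y₁ ℕP.≤-refl x₁≥1 F₀≡1
  open ReachesUnit reached using (j)

  x₁≡p[j] : x₁ ≡ p j
  x₁≡p[j] = trans (sym (pick x₁ y₁)) (ReachesUnit.p-eq reached)
    where
    pick : ∀ x y → 1 * x + 0 * y ≡ x
    pick = ℕ-solve

  y₁≡q[j] : y₁ ≡ q j
  y₁≡q[j] = trans (sym (pick x₁ y₁)) (ReachesUnit.q-eq reached)
    where
    pick : ∀ x y → 0 * x + 1 * y ≡ y
    pick = ℕ-solve

  j≥1 : 1 ≤ j
  j≥1 = ℕP.≮⇒≥ λ j<1 → ℕP.<⇒≱ y₁≥1 (ℕP.≤-reflexive (trans y₁≡q[j] (cong q (ℕP.n<1⇒n≡0 j<1))))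

  c[suc[j∸1]]≡1 : c (suc (j ∸ 1)) ≡ 1
  c[suc[j∸1]]≡1 = trans (cong c (suc[n∸1]≡n j≥1)) (ReachesUnit.c≡1 reached)

  L∣j : L ∣ j
  L∣j = minimal-period-divides L≥1 period minimal
          (subst (Period (cf d)) (suc[n∸1]≡n j≥1) (period-at-unit (j ∸ 1) c[suc[j∸1]]≡1))

  t : ℕ
  t = _∣_.quotient L∣j

  j≡t*L : j ≡ t * L
  j≡t*L = _∣_.equality L∣j

  t≥1 : 1 ≤ t
  t≥1 = ℕP.≮⇒≥ λ t<1 → ℕP.<⇒≢ j≥1 (sym (trans j≡t*L (cong (_* L) (ℕP.n<1⇒n≡0 t<1))))

  a[L]≡2r : a L ≡ r + r
  a[L]≡2r = begin
    a L                        ≡⟨ period-iterate period (t ∸ 1) L L≥1 ⟨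
    a (L + (t ∸ 1) * L)        ≡⟨ cong (λ u → a (u * L)) (suc[n∸1]≡n t≥1) ⟩
    a (t * L)                  ≡⟨ cong a j≡t*L ⟨
    a j                        ≡⟨ cong a (suc[n∸1]≡n j≥1) ⟨
    a (suc (j ∸ 1))            ≡⟨ a≡2r-at-unit (j ∸ 1) c[suc[j∸1]]≡1 ⟩
    r + r                      ∎
    where open ≡-Reasoning

  -- a_L c_L ≤ m_L + r ≤ 2r = a_L forces c_L = 1
  c[L]≡1 : c L ≡ 1
  c[L]≡1 = ℕP.≤-antisym (ℕP.*-cancelˡ-≤ (r + r) {{2r≢0}} (begin
    (r + r) * c L     ≡⟨ cong (_* c L) a[L]≡2r ⟨
    a L * c L         ≤⟨ Step.a*c≤m+r (step-at L) ⟩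
    m L + r           ≤⟨ ℕP.+-monoˡ-≤ r (Reduced.m≤r (reduced L)) ⟩
    r + r             ≡⟨ ℕP.*-identityʳ (r + r) ⟨
    (r + r) * 1       ∎)) (Reduced.c≥1 (reduced L))
    where
    open ℕP.≤-Reasoning
    2r≢0 = ℕ.>-nonZero (ℕP.≤-trans r≥1 (ℕP.m≤m+n r r))

  X Y : ℕ → ℕ
  X n = proj₁ (pellPower d x₁ y₁ n)
  Y n = proj₂ (pellPower d x₁ y₁ n)

  record IsUnitIndex (P : ℕ) : Set where
    field
      2≤P  : 2 ≤ P
      c≡1  : c P ≡ 1
      even : sign P ≡ + 1
      P∣j  : P ∣ j

  module _ {P : ℕ} (unit : IsUnitIndex P) where
    open IsUnitIndex unit

    P≥1 : 1 ≤ P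
    P≥1 = ℕP.≤-trans (s≤s z≤n) 2≤P

    fundamental-at-unit-index : x₁ ≡ p P × y₁ ≡ q P
    fundamental-at-unit-index = j≡P (_∣_.quotient P∣j) (_∣_.equality P∣j)
      where
      y₁≤q[P] : y₁ ≤ q P
      y₁≤q[P] = least (p P) (q P) (p-pos P) (subst (λ u → 1 ≤ q u) (suc[n∸1]≡n P≥1) (q-pos (P ∸ 1)))
                  (pell-at-unit P c≡1 even)
      j≡P : ∀ s → j ≡ s * P → x₁ ≡ p P × y₁ ≡ q P
      j≡P zero          j≡0  = ⊥-elim (ℕP.<⇒≢ j≥1 (sym j≡0))
      j≡P (suc zero)    j≡P′ = trans x₁≡p[j] (cong p j≡P″) , trans y₁≡q[j] (cong q j≡P″)
        where
        j≡P″ = trans j≡P′ (ℕP.+-identityʳ P)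
      j≡P (suc (suc s)) j≡sP = ⊥-elim (ℕP.<⇒≱ (ℕP.<-≤-trans (q-strictMono 2≤P P<j) (ℕP.≤-reflexive (sym y₁≡q[j]))) y₁≤q[P])
        where
        P<j : P < j
        P<j = ℕP.<-≤-trans (ℕP.m<m+n P (ℕP.≤-trans P≥1 (ℕP.m≤m+n P (s * P)))) (ℕP.≤-reflexive (sym j≡sP))

    convergents-at-unit-index : ∀ n → 1 ≤ n → convP d (n * P ∸ 1) ≡ X n × convQ d (n * P ∸ 1) ≡ Y n
    convergents-at-unit-index n n≥1 =
      trans (convP≡p (n * P ∸ 1)) (trans (cong p suc[nP∸1]≡nP) (proj₁ powers)) ,
      trans (convQ≡q (n * P ∸ 1)) (trans (cong q suc[nP∸1]≡nP) (proj₂ powers))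
      where
      suc[nP∸1]≡nP = suc[n∸1]≡n (ℕP.*-mono-≤ n≥1 P≥1)
      P₀ = P ∸ 1
      open UnitShift P₀ (trans (cong c (suc[n∸1]≡n P≥1)) c≡1) using (convergents-at-multiples)
      fundamental : x₁ ≡ p (suc P₀) × y₁ ≡ q (suc P₀)
      fundamental = subst (λ u → x₁ ≡ p u × y₁ ≡ q u) (sym (suc[n∸1]≡n P≥1)) fundamental-at-unit-index
      powers : p (n * P) ≡ X n × q (n * P) ≡ Y n
      powers = subst (λ u → p (n * u) ≡ X n × q (n * u) ≡ Y n) (suc[n∸1]≡n P≥1)
        (subst₂ (λ x y → p (n * suc P₀) ≡ proj₁ (pellPower d x y n) × q (n * suc P₀) ≡ proj₂ (pellPower d x y n))
          (sym (proj₁ fundamental)) (sym (proj₂ fundamental)) (convergents-at-multiples n))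

  even-unit-index : 2 ∣ L → IsUnitIndex L
  even-unit-index 2∣L@(divides h L≡h*2) = record
    { 2≤P = ℕP.≤-trans (ℕP.*-monoˡ-≤ 2 h≥1) (ℕP.≤-reflexive (sym L≡h*2))
    ; c≡1 = c[L]≡1 ; even = sign-even 2∣L ; P∣j = L∣j }
    where
    h≥1 : 1 ≤ h
    h≥1 = ℕP.≮⇒≥ λ h<1 → ℕP.<⇒≢ L≥1 (sym (trans L≡h*2 (cong (_* 2) (ℕP.n<1⇒n≡0 h<1))))

  odd-unit-index : ¬ 2 ∣ L → IsUnitIndex (2 * L)
  odd-unit-index 2∤L = record
    { 2≤P = ℕP.*-monoʳ-≤ 2 L≥1 ; c≡1 = c[2L]≡1 ; even = sign-even (m∣m*n L) ; P∣j = 2L∣j }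
    where
    c[2L]≡1 : c (2 * L) ≡ 1
    c[2L]≡1 = begin
      c (2 * L)                          ≡⟨ cong (λ u → c (u + (u + 0))) (suc[n∸1]≡n L≥1) ⟨
      c (suc (L ∸ 1) + (suc (L ∸ 1) + 0)) ≡⟨ cong (λ u → c (suc (L ∸ 1) + u)) (ℕP.+-identityʳ (suc (L ∸ 1))) ⟩
      c (suc (L ∸ 1) + suc (L ∸ 1))      ≡⟨ cong proj₂ (state-repeats (L ∸ 1) c[suc[L∸1]]≡1 (L ∸ 1)) ⟩
      c (suc (L ∸ 1))                    ≡⟨ c[suc[L∸1]]≡1 ⟩
      1                                  ∎
      where
      open ≡-Reasoning
      c[suc[L∸1]]≡1 : c (suc (L ∸ 1)) ≡ 1
      c[suc[L∸1]]≡1 = trans (cong c (suc[n∸1]≡n L≥1)) c[L]≡1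
    2∣t : 2 ∣ t
    2∣t = [ (λ 2∣t → 2∣t) , (λ 2∣L → ⊥-elim (2∤L 2∣L)) ]′
            (euclidsLemma t L prime[2] (subst (2 ∣_) j≡t*L (sign≡1⇒even j (ReachesUnit.even reached))))
    2L∣j : 2 * L ∣ j
    2L∣j = double (_∣_.quotient 2∣t) (_∣_.equality 2∣t)
      where
      double : ∀ s → t ≡ s * 2 → 2 * L ∣ j
      double s t≡s*2 = divides s (trans j≡t*L (trans (cong (_* L) t≡s*2) (regroup s L)))
        where
        regroup : ∀ s L → s * 2 * L ≡ s * (2 * L)
        regroup = ℕ-solve

mainTheorem8 : (d : ℕ) → 1 ≤ d → (¬ Σ ℕ (λ s → s * s ≡ d))
    → (x₁ y₁ : ℕ) → 1 ≤ x₁ → 1 ≤ y₁ → x₁ * x₁ ≡ d * (y₁ * y₁) + 1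
    → ((x y : ℕ) → 1 ≤ x → 1 ≤ y → x * x ≡ d * (y * y) + 1 → y₁ ≤ y)
    → (L : ℕ) → 1 ≤ L
    → ((k : ℕ) → 1 ≤ k → cf d (k + L) ≡ cf d k)
    → ((L′ : ℕ) → 1 ≤ L′ → ((k : ℕ) → 1 ≤ k → cf d (k + L′) ≡ cf d k) → L ≤ L′)
    → (n : ℕ) → 1 ≤ n
    → let z = frac (x₁ + 1) y₁
          N = Nr (2 * n) (ι d) z
          D = Dr (2 * n) (ι d) z
      in D ≢ 0ℚ
         × (2 ∣ L → N ℚ.* ι (convQ d (n * L ∸ 1)) ≡ ι (convP d (n * L ∸ 1)) ℚ.* D)
         × (¬ 2 ∣ L → N ℚ.* ι (convQ d (2 * n * L ∸ 1)) ≡ ι (convP d (2 * n * L ∸ 1)) ℚ.* D)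
mainTheorem8 d _ nonsquare x₁ y₁@(suc y₀) x₁≥1 y₁≥1 pell least L L≥1 period minimal n n≥1 =
  Dr≢0 n (proj₂ (pellPower-pos x₁≥1 y₁≥1 n) n≥1) ,
  (λ 2∣L → cross-at-convergent {n * L ∸ 1} (convergents-at-unit-index (even-unit-index 2∣L) n n≥1)) ,
  (λ 2∤L → cross-at-convergent {2 * n * L ∸ 1} (subst (λ k → convP d (k ∸ 1) ≡ X n × convQ d (k ∸ 1) ≡ Y n) (regroup n L)
                      (convergents-at-unit-index (odd-unit-index 2∤L) n n≥1)))
  where
  r²<d : isqrt d * isqrt d < d
  r²<d = ℕP.≤∧≢⇒< (isqrtAux-sq≤ d d) (λ r²≡d → nonsquare (isqrt d , r²≡d))
  open RedeiAtPellPoint d x₁ y₀ pell using (Dr≢0; Nr*Y≡X*Dr)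
  open FundamentalSolution d r²<d x₁ y₁ x₁≥1 y₁≥1 pell least L L≥1 period minimal
  N = Nr (2 * n) (ι d) (frac (x₁ + 1) y₁)
  D = Dr (2 * n) (ι d) (frac (x₁ + 1) y₁)
  cross-at-convergent : ∀ {k} → convP d k ≡ X n × convQ d k ≡ Y n → N ℚ.* ι (convQ d k) ≡ ι (convP d k) ℚ.* D
  cross-at-convergent {k} (p≡X , q≡Y) = begin
    N ℚ.* ι (convQ d k)   ≡⟨ cong (λ t → N ℚ.* ι t) q≡Y ⟩
    N ℚ.* ι (Y n)         ≡⟨ Nr*Y≡X*Dr n ⟩
    ι (X n) ℚ.* D         ≡⟨ cong (λ t → ι t ℚ.* D) p≡X ⟨
    ι (convP d k) ℚ.* D   ∎
    where open ≡-Reasoning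
  regroup : ∀ n L → n * (2 * L) ≡ 2 * n * L
  regroup = ℕ-solve
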